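{- Let $Z$ and $W$ be skew-symmetric $c\times c$ integer matrices. (a) If $W$ is $\mathbb{Z}$-invertible, then there is a $c\times c$ integer matrix $Y$ with $Z=Y^{\mathrm{tr}}WY$. (b) If $W$ is pure, then there is a $c\times c$ integer matrix $Y$ with $Z=Y-Y^{\mathrm{tr}}+Y^{\mathrm{tr}}WY$.
   Context: An integer $c\times c$ matrix $W$ is pure if its image $W(\mathbb{Z}^c)$ is a pure subgroup of $\mathbb{Z}^c$, i.e. whenever $ax\in W(\mathbb{Z}^c)$ with $x\in\mathbb{Z}^c$ and $0\ne a\in\mathbb{Z}$, then $x\in W(\mathbb{Z}^c)$. -}

module Defs where

open import Data.Nat using (ℕ; zero; suc)
open import Data.Fin using (Fin; zero; suc; _≟_)
open import Data.Integer using (ℤ; _+_; _*_; -_; 0ℤ; 1ℤ)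
open import Data.Product using (∃; _×_)
open import Relation.Nullary using (¬_; yes; no)
open import Relation.Binary.PropositionalEquality using (_≡_)

Vecℤ : ℕ → Set
Vecℤ c = Fin c → ℤ

Mat : ℕ → Set
Mat c = Fin c → Fin c → ℤ

Σℤ : ∀ {n} → (Fin n → ℤ) → ℤ
Σℤ {zero}  f = 0ℤ
Σℤ {suc n} f = f zero + Σℤ (λ i → f (suc i))

_·_ : ∀ {c} → Mat c → Mat c → Mat c
(A · B) i j = Σℤ (λ k → A i k * B k j)

_⊕_ : ∀ {c} → Mat c → Mat c → Mat c
(A ⊕ B) i j = A i j + B i j

⊖_ : ∀ {c} → Mat c → Mat c
(⊖ A) i j = - A i j

_ᵗ : ∀ {c} → Mat c → Mat c
(A ᵗ) i j = A j i

I : ∀ {c} → Mat c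
I i j with i ≟ j
... | yes _ = 1ℤ
... | no  _ = 0ℤ

_▷_ : ∀ {c} → Mat c → Vecℤ c → Vecℤ c
(A ▷ x) i = Σℤ (λ k → A i k * x k)

_⋆_ : ∀ {c} → ℤ → Vecℤ c → Vecℤ c
(a ⋆ x) i = a * x i

_≋_ : ∀ {c} → Mat c → Mat c → Set
A ≋ B = ∀ i j → A i j ≡ B i j

_≐_ : ∀ {c} → Vecℤ c → Vecℤ c → Set
x ≐ y = ∀ i → x i ≡ y i

SkewSymmetric : ∀ {c} → Mat c → Set
SkewSymmetric W = (W ᵗ) ≋ (⊖ W)

ZInvertible : ∀ {c} → Mat c → Set
ZInvertible {c} W = ∃ λ (V : Mat c) → ((W · V) ≋ I) × ((V · W) ≋ I)

InImage : ∀ {c} → Mat c → Vecℤ c → Set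
InImage {c} W x = ∃ λ (y : Vecℤ c) → (W ▷ y) ≐ x

-- W(ℤ^c) is a pure subgroup of ℤ^c
Pure : ∀ {c} → Mat c → Set
Pure {c} W = ∀ (a : ℤ) (x : Vecℤ c) → ¬ (a ≡ 0ℤ) → InImage W (a ⋆ x) → InImage W x

-- Transvection congruences and Euclid's algorithm bring every skew-symmetric integer
-- matrix to a block sum of hyperbolic planes d [[0,1],[-1,0]] followed by a zero block.
-- Invertibility and purity are invariant under congruence, and on such a normal form they
-- force every d to be ±1 (invertibility also excludes the zero block).
-- (a) A normal form with unit blocks and no zero block carries hyperbolic u to hyperbolic d
-- by diag(1, u d), so it represents every normal form, hence every skew Z.
-- (b) For a unit form U we have U² = -I, and Y = X - U solves the equation as soon as
-- XᵗUX = Z + U, which (a) provides. For a pure W the normal form is U ⊞ 0; there Y is made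
-- of the solution for U, a splitting Y₂ - Y₂ᵗ of the zero-block part of Z, and the
-- off-diagonal block of Z.
module Submission where

open import Defs
open import Data.Nat as ℕ using (ℕ; zero; suc)
open import Data.Fin as Fin using (Fin; zero; suc; _↑ʳ_)
open import Data.Fin.Patterns using (0F; 1F)
import Data.Fin.Properties as FinP
open import Data.Integer as ℤ using (ℤ; _+_; _*_; -_; 0ℤ; 1ℤ; ∣_∣)
import Data.Integer.Properties as ℤP
import Data.Integer.DivMod as ℤDM
import Data.Nat.Properties as ℕP
open import Data.Integer.Tactic.RingSolver using (solve-∀)
open import Algebra.Properties.Semiring.Sum ℤP.+-*-semiring
  using (sum; sum-cong-≗; sum-replicate-zero; ∑-distrib-+; ∑-comm; *-distribˡ-sum; *-distribʳ-sum)
open import Data.Product using (∃; _×_; _,_; proj₁; proj₂)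
open import Data.Sum as Sum using (_⊎_; inj₁; inj₂)
open import Data.List using (List; []; _∷_; allFin)
open import Data.List.Relation.Unary.Any using (here; there)
open import Data.List.Membership.Propositional using (_∈_)
open import Data.List.Membership.Propositional.Properties using (∈-allFin)
open import Induction.WellFounded using (Acc; acc)
open import Function using (id)
open import Data.Unit using (⊤; tt)
open import Data.Nat.Induction using (<-wellFounded)
open import Data.Empty using (⊥-elim)
open import Relation.Nullary using (yes; no)
open import Relation.Binary.Bundles using (Setoid)
import Relation.Binary.Reasoning.Setoid as SetoidReasoning
open import Relation.Binary.PropositionalEquality

-- Matrix algebra

Σℤ≡sum : ∀ {n} (f : Fin n → ℤ) → Σℤ f ≡ sum f
Σℤ≡sum {zero}  f = refl
Σℤ≡sum {suc n} f = cong (f zero +_) (Σℤ≡sum (λ i → f (suc i)))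

Σ-cong : ∀ {n} {f g : Fin n → ℤ} → (∀ i → f i ≡ g i) → Σℤ f ≡ Σℤ g
Σ-cong {zero}  e = refl
Σ-cong {suc n} e = cong₂ _+_ (e zero) (Σ-cong (λ i → e (suc i)))

Σ-zero : ∀ {n} {f : Fin n → ℤ} → (∀ i → f i ≡ 0ℤ) → Σℤ f ≡ 0ℤ
Σ-zero {n} {f} e = trans (Σℤ≡sum f) (trans (sum-cong-≗ e) (sum-replicate-zero n))

Σ-distrib-+ : ∀ {n} (f g : Fin n → ℤ) → Σℤ (λ i → f i + g i) ≡ Σℤ f + Σℤ g
Σ-distrib-+ f g rewrite Σℤ≡sum (λ i → f i + g i) | Σℤ≡sum f | Σℤ≡sum g = ∑-distrib-+ f g

*-distribˡ-Σ : ∀ {n} a (f : Fin n → ℤ) → a * Σℤ f ≡ Σℤ (λ i → a * f i)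
*-distribˡ-Σ a f rewrite Σℤ≡sum f | Σℤ≡sum (λ i → a * f i) = *-distribˡ-sum a f

*-distribʳ-Σ : ∀ {n} a (f : Fin n → ℤ) → Σℤ f * a ≡ Σℤ (λ i → f i * a)
*-distribʳ-Σ a f rewrite Σℤ≡sum f | Σℤ≡sum (λ i → f i * a) = *-distribʳ-sum a f

neg-distrib-Σ : ∀ {n} (f : Fin n → ℤ) → - Σℤ f ≡ Σℤ (λ i → - f i)
neg-distrib-Σ {zero}  f = refl
neg-distrib-Σ {suc n} f =
  trans (ℤP.neg-distrib-+ (f zero) _) (cong (- f zero +_) (neg-distrib-Σ (λ i → f (suc i))))

Σ-comm : ∀ {m n} (f : Fin m → Fin n → ℤ) →
  Σℤ (λ i → Σℤ (λ j → f i j)) ≡ Σℤ (λ j → Σℤ (λ i → f i j))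
Σ-comm f = begin
  Σℤ (λ i → Σℤ (f i))             ≡⟨ Σ-cong (λ i → Σℤ≡sum (f i)) ⟩
  Σℤ (λ i → sum (f i))            ≡⟨ Σℤ≡sum (λ i → sum (f i)) ⟩
  sum (λ i → sum (f i))           ≡⟨ ∑-comm f ⟩
  sum (λ j → sum (λ i → f i j))   ≡⟨ Σℤ≡sum (λ j → sum (λ i → f i j)) ⟨
  Σℤ (λ j → sum (λ i → f i j))    ≡⟨ Σ-cong (λ j → Σℤ≡sum (λ i → f i j)) ⟨
  Σℤ (λ j → Σℤ (λ i → f i j))     ∎
  where open ≡-Reasoning

-- I is defined through _≟_, which does not compute on open indices; δ is the same
-- matrix defined by structural recursion.
δ : ∀ {n} → Mat n
δ zero    zero    = 1ℤ
δ zero    (suc j) = 0ℤ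
δ (suc i) zero    = 0ℤ
δ (suc i) (suc j) = δ i j

I≡δ : ∀ {n} (i j : Fin n) → I i j ≡ δ i j
I≡δ zero    zero    = refl
I≡δ zero    (suc j) = refl
I≡δ (suc i) zero    = refl
I≡δ (suc i) (suc j) with i Fin.≟ j | I≡δ i j
... | yes refl | e = e
... | no _     | e = e

δ-sym : ∀ {n} (i j : Fin n) → δ i j ≡ δ j i
δ-sym zero    zero    = refl
δ-sym zero    (suc j) = refl
δ-sym (suc i) zero    = refl
δ-sym (suc i) (suc j) = δ-sym i j

δ-diag : ∀ {n} (i : Fin n) → δ i i ≡ 1ℤ
δ-diag zero    = refl
δ-diag (suc i) = δ-diag i

δ-off : ∀ {n} {i j : Fin n} → i ≢ j → δ i j ≡ 0ℤ
δ-off {i = zero}  {zero}  i≢j = ⊥-elim (i≢j refl)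
δ-off {i = zero}  {suc j} i≢j = refl
δ-off {i = suc i} {zero}  i≢j = refl
δ-off {i = suc i} {suc j} i≢j = δ-off (λ e → i≢j (cong suc e))

Σ-δˡ : ∀ {n} (i : Fin n) (f : Fin n → ℤ) → Σℤ (λ k → δ i k * f k) ≡ f i
Σ-δˡ {suc n} zero    f rewrite Σ-zero {n} (λ k → ℤP.*-zeroˡ (f (suc k))) =
  trans (ℤP.+-identityʳ _) (ℤP.*-identityˡ _)
Σ-δˡ {suc n} (suc i) f rewrite ℤP.*-zeroˡ (f zero) =
  trans (ℤP.+-identityˡ _) (Σ-δˡ i (λ k → f (suc k)))

Σ-δʳ : ∀ {n} (j : Fin n) (f : Fin n → ℤ) → Σℤ (λ k → f k * δ k j) ≡ f j
Σ-δʳ j f = trans (Σ-cong (λ k → trans (ℤP.*-comm (f k) _) (cong (_* f k) (δ-sym k j)))) (Σ-δˡ j f)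

≋-refl : ∀ {c} {A : Mat c} → A ≋ A
≋-refl i j = refl

≋-sym : ∀ {c} {A B : Mat c} → A ≋ B → B ≋ A
≋-sym e i j = sym (e i j)

≋-trans : ∀ {c} {A B C : Mat c} → A ≋ B → B ≋ C → A ≋ C
≋-trans e f i j = trans (e i j) (f i j)

≋-setoid : ℕ → Setoid _ _
≋-setoid c = record
  { Carrier = Mat c ; _≈_ = _≋_
  ; isEquivalence = record { refl = ≋-refl ; sym = ≋-sym ; trans = ≋-trans } }

·-cong : ∀ {c} {A A′ B B′ : Mat c} → A ≋ A′ → B ≋ B′ → (A · B) ≋ (A′ · B′)
·-cong e f i j = Σ-cong (λ k → cong₂ _*_ (e i k) (f k j))

·-congˡ : ∀ {c} (A : Mat c) {B B′ : Mat c} → B ≋ B′ → (A · B) ≋ (A · B′)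
·-congˡ A e = ·-cong {A = A} ≋-refl e

·-congʳ : ∀ {c} (B : Mat c) {A A′ : Mat c} → A ≋ A′ → (A · B) ≋ (A′ · B)
·-congʳ B e = ·-cong {B = B} e ≋-refl

⊕-cong : ∀ {c} {A A′ B B′ : Mat c} → A ≋ A′ → B ≋ B′ → (A ⊕ B) ≋ (A′ ⊕ B′)
⊕-cong e f i j = cong₂ _+_ (e i j) (f i j)

⊖-cong : ∀ {c} {A B : Mat c} → A ≋ B → (⊖ A) ≋ (⊖ B)
⊖-cong e i j = cong -_ (e i j)

ᵗ-cong : ∀ {c} {A B : Mat c} → A ≋ B → (A ᵗ) ≋ (B ᵗ)
ᵗ-cong e i j = e j i

·-assoc : ∀ {c} (A B C : Mat c) → ((A · B) · C) ≋ (A · (B · C))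
·-assoc A B C i j = begin
  Σℤ (λ k → Σℤ (λ l → A i l * B l k) * C k j)   ≡⟨ Σ-cong (λ k → *-distribʳ-Σ (C k j) (λ l → A i l * B l k)) ⟩
  Σℤ (λ k → Σℤ (λ l → A i l * B l k * C k j))   ≡⟨ Σ-comm (λ k l → A i l * B l k * C k j) ⟩
  Σℤ (λ l → Σℤ (λ k → A i l * B l k * C k j))   ≡⟨ Σ-cong (λ l → Σ-cong (λ k → ℤP.*-assoc (A i l) (B l k) (C k j))) ⟩
  Σℤ (λ l → Σℤ (λ k → A i l * (B l k * C k j))) ≡⟨ Σ-cong (λ l → *-distribˡ-Σ (A i l) (λ k → B l k * C k j)) ⟨
  Σℤ (λ l → A i l * Σℤ (λ k → B l k * C k j))   ∎
  where open ≡-Reasoning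

ᵗ-· : ∀ {c} (A B : Mat c) → ((A · B) ᵗ) ≋ ((B ᵗ) · (A ᵗ))
ᵗ-· A B i j = Σ-cong (λ k → ℤP.*-comm (A j k) (B k i))

ᵗ-I : ∀ {c} → (I {c} ᵗ) ≋ I
ᵗ-I i j = trans (I≡δ j i) (trans (δ-sym j i) (sym (I≡δ i j)))

·-identityˡ : ∀ {c} (A : Mat c) → (I · A) ≋ A
·-identityˡ A i j = trans (Σ-cong (λ k → cong (_* A k j) (I≡δ i k))) (Σ-δˡ i (λ k → A k j))

·-identityʳ : ∀ {c} (A : Mat c) → (A · I) ≋ A
·-identityʳ A i j = trans (Σ-cong (λ k → cong (A i k *_) (I≡δ k j))) (Σ-δʳ j (A i))

·-distribˡ-⊕ : ∀ {c} (A B C : Mat c) → (A · (B ⊕ C)) ≋ ((A · B) ⊕ (A · C))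
·-distribˡ-⊕ A B C i j =
  trans (Σ-cong (λ k → ℤP.*-distribˡ-+ (A i k) (B k j) (C k j)))
        (Σ-distrib-+ (λ k → A i k * B k j) (λ k → A i k * C k j))

·-distribʳ-⊕ : ∀ {c} (A B C : Mat c) → ((A ⊕ B) · C) ≋ ((A · C) ⊕ (B · C))
·-distribʳ-⊕ A B C i j =
  trans (Σ-cong (λ k → ℤP.*-distribʳ-+ (C k j) (A i k) (B i k)))
        (Σ-distrib-+ (λ k → A i k * C k j) (λ k → B i k * C k j))

·-⊖ʳ : ∀ {c} (A B : Mat c) → (A · (⊖ B)) ≋ (⊖ (A · B))
·-⊖ʳ A B i j =
  trans (Σ-cong (λ k → sym (ℤP.neg-distribʳ-* (A i k) (B k j)))) (sym (neg-distrib-Σ (λ k → A i k * B k j)))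

·-⊖ˡ : ∀ {c} (A B : Mat c) → ((⊖ A) · B) ≋ (⊖ (A · B))
·-⊖ˡ A B i j =
  trans (Σ-cong (λ k → sym (ℤP.neg-distribˡ-* (A i k) (B k j)))) (sym (neg-distrib-Σ (λ k → A i k * B k j)))

sandwich : ∀ {c} → Mat c → Mat c → Mat c
sandwich A G = (A ᵗ) · (G · A)

sandwich-cong : ∀ {c} (A : Mat c) {G G′ : Mat c} → G ≋ G′ → sandwich A G ≋ sandwich A G′
sandwich-cong A e = ·-congˡ (A ᵗ) (·-congʳ A e)

sandwich-congˡ : ∀ {c} {A A′ : Mat c} (G : Mat c) → A ≋ A′ → sandwich A G ≋ sandwich A′ G
sandwich-congˡ G e = ·-cong (ᵗ-cong e) (·-congˡ G e)

sandwich-I : ∀ {c} (G : Mat c) → sandwich I G ≋ G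
sandwich-I G = ≋-trans (·-cong ᵗ-I (·-identityʳ G)) (·-identityˡ G)

sandwich-· : ∀ {c} (A R G : Mat c) → sandwich A (sandwich R G) ≋ sandwich (R · A) G
sandwich-· {c} A R G = begin
  (A ᵗ) · (((R ᵗ) · (G · R)) · A) ≈⟨ ·-congˡ (A ᵗ) (·-assoc (R ᵗ) (G · R) A) ⟩
  (A ᵗ) · ((R ᵗ) · ((G · R) · A)) ≈⟨ ·-congˡ (A ᵗ) (·-congˡ (R ᵗ) (·-assoc G R A)) ⟩
  (A ᵗ) · ((R ᵗ) · (G · (R · A))) ≈⟨ ·-assoc (A ᵗ) (R ᵗ) (G · (R · A)) ⟨
  ((A ᵗ) · (R ᵗ)) · (G · (R · A)) ≈⟨ ·-congʳ (G · (R · A)) (ᵗ-· R A) ⟨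
  ((R · A) ᵗ) · (G · (R · A))     ∎
  where open SetoidReasoning (≋-setoid c)

sandwich-ᵗ : ∀ {c} (A G : Mat c) → ((sandwich A G) ᵗ) ≋ sandwich A (G ᵗ)
sandwich-ᵗ A G = ≋-trans (ᵗ-· (A ᵗ) (G · A)) (≋-trans (·-congʳ A (ᵗ-· G A)) (·-assoc (A ᵗ) (G ᵗ) A))

sandwich-⊕ : ∀ {c} (A G H : Mat c) → sandwich A (G ⊕ H) ≋ (sandwich A G ⊕ sandwich A H)
sandwich-⊕ A G H = ≋-trans (·-congˡ (A ᵗ) (·-distribʳ-⊕ G H A)) (·-distribˡ-⊕ (A ᵗ) (G · A) (H · A))

sandwich-⊖ : ∀ {c} (A G : Mat c) → sandwich A (⊖ G) ≋ (⊖ sandwich A G)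
sandwich-⊖ A G = ≋-trans (·-congˡ (A ᵗ) (·-⊖ˡ G A)) (·-⊖ʳ (A ᵗ) (G · A))

skew-sandwich : ∀ {c} (A : Mat c) {G : Mat c} → SkewSymmetric G → SkewSymmetric (sandwich A G)
skew-sandwich A {G} skew = ≋-trans (sandwich-ᵗ A G) (≋-trans (sandwich-cong A skew) (sandwich-⊖ A G))

skew-⊕ : ∀ {c} {A B : Mat c} → SkewSymmetric A → SkewSymmetric B → SkewSymmetric (A ⊕ B)
skew-⊕ {A = A} {B} skewA skewB i j = trans (cong₂ _+_ (skewA i j) (skewB i j)) (sym (ℤP.neg-distrib-+ (A i j) (B i j)))

skew-diag : ∀ {c} {G : Mat c} → SkewSymmetric G → ∀ i → G i i ≡ 0ℤ
skew-diag {G = G} skew i = x≡-x⇒x≡0 (G i i) (skew i i)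
  where
  x≡-x⇒x≡0 : ∀ x → x ≡ - x → x ≡ 0ℤ
  x≡-x⇒x≡0 (ℤ.+ zero)    _ = refl
  x≡-x⇒x≡0 ℤ.+[1+ n ]   ()
  x≡-x⇒x≡0 ℤ.-[1+ n ]   ()

skew-≢0 : ∀ {c} {G : Mat c} {i j} → SkewSymmetric G → G i j ≢ 0ℤ → G j i ≢ 0ℤ
skew-≢0 {i = i} {j} skew nz e = nz (trans (skew j i) (cong -_ e))

record Inverses {c} (P Q : Mat c) : Set where
  constructor inverses
  field
    PQ≋I : (P · Q) ≋ I
    QP≋I : (Q · P) ≋ I

inverses-· : ∀ {c} {P P′ R R′ : Mat c} → Inverses P P′ → Inverses R R′ → Inverses (R · P) (P′ · R′)
inverses-· {c} {P} {P′} {R} {R′} (inverses PP′ P′P) (inverses RR′ R′R) =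
  inverses (cancel R P P′ R′ PP′ RR′) (cancel P′ R′ R P R′R P′P)
  where
  cancel : ∀ (A B C D : Mat c) → (B · C) ≋ I → (A · D) ≋ I → ((A · B) · (C · D)) ≋ I
  cancel A B C D BC AD = begin
    (A · B) · (C · D) ≈⟨ ·-assoc A B (C · D) ⟩
    A · (B · (C · D)) ≈⟨ ·-congˡ A (·-assoc B C D) ⟨
    A · ((B · C) · D) ≈⟨ ·-congˡ A (·-congʳ D BC) ⟩
    A · (I · D)       ≈⟨ ·-congˡ A (·-identityˡ D) ⟩
    A · D             ≈⟨ AD ⟩
    I                 ∎
    where open SetoidReasoning (≋-setoid c)

ᵗ-inverse : ∀ {c} (P Q : Mat c) → (Q · P) ≋ I → ((P ᵗ) · (Q ᵗ)) ≋ I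
ᵗ-inverse P Q QP = ≋-trans (≋-sym (ᵗ-· Q P)) (≋-trans (ᵗ-cong QP) ᵗ-I)

inverses-ᵗ : ∀ {c} {P Q : Mat c} → Inverses P Q → Inverses (P ᵗ) (Q ᵗ)
inverses-ᵗ {P = P} {Q} (inverses PQ QP) = inverses (ᵗ-inverse P Q QP) (ᵗ-inverse Q P PQ)

-- Congruence

record _∼_ {c} (Z G : Mat c) : Set where
  constructor congruent
  field
    Q Q⁻¹    : Mat c
    Q-inverses : Inverses Q Q⁻¹
    equation : Z ≋ sandwich Q G

≋⇒∼ : ∀ {c} {Z G : Mat c} → Z ≋ G → Z ∼ G
≋⇒∼ {G = G} e = congruent I I (inverses (·-identityˡ I) (·-identityˡ I)) (≋-trans e (≋-sym (sandwich-I G)))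

∼-trans : ∀ {c} {Z G H : Mat c} → Z ∼ G → G ∼ H → Z ∼ H
∼-trans {H = H} (congruent Q Q⁻¹ invQ eQ) (congruent R R⁻¹ invR eR) =
  congruent (R · Q) (Q⁻¹ · R⁻¹) (inverses-· invQ invR)
    (≋-trans eQ (≋-trans (sandwich-cong Q eR) (sandwich-· Q R H)))

∼-sym : ∀ {c} {Z G : Mat c} → Z ∼ G → G ∼ Z
∼-sym {c} {Z} {G} (congruent Q Q⁻¹ (inverses QQ⁻¹ Q⁻¹Q) eQ) =
  congruent Q⁻¹ Q (inverses Q⁻¹Q QQ⁻¹) (≋-sym (begin
    sandwich Q⁻¹ Z              ≈⟨ sandwich-cong Q⁻¹ eQ ⟩
    sandwich Q⁻¹ (sandwich Q G) ≈⟨ sandwich-· Q⁻¹ Q G ⟩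
    sandwich (Q · Q⁻¹) G        ≈⟨ sandwich-congˡ G QQ⁻¹ ⟩
    sandwich I G                ≈⟨ sandwich-I G ⟩
    G                           ∎))
  where open SetoidReasoning (≋-setoid c)

∼-sandwich : ∀ {c} {P P⁻¹ : Mat c} → Inverses P P⁻¹ → (G : Mat c) → G ∼ sandwich P G
∼-sandwich invP G = ∼-sym (congruent _ _ invP ≋-refl)


-- Normal form of skew-symmetric matrices

-- Right multiplication by  transvection j k m  adds m times column k to column j.
transvection : ∀ {n} → Fin n → Fin n → ℤ → Mat n
transvection j k m a b = δ a b + δ a k * (δ j b * m)

·-transvection : ∀ {n} (A : Mat n) j k m a b →
  (A · transvection j k m) a b ≡ A a b + A a k * (δ j b * m)
·-transvection A j k m a b = begin
  Σℤ (λ x → A a x * (δ x b + δ x k * (δ j b * m)))             ≡⟨ Σ-cong (λ x → ℤP.*-distribˡ-+ (A a x) _ _) ⟩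
  Σℤ (λ x → A a x * δ x b + A a x * (δ x k * (δ j b * m)))     ≡⟨ Σ-distrib-+ (λ x → A a x * δ x b) _ ⟩
  Σℤ (λ x → A a x * δ x b) + Σℤ (λ x → A a x * (δ x k * (δ j b * m)))
    ≡⟨ cong₂ _+_ (Σ-δʳ b (A a)) (Σ-cong (λ x → sym (ℤP.*-assoc (A a x) (δ x k) _))) ⟩
  A a b + Σℤ (λ x → A a x * δ x k * (δ j b * m))               ≡⟨ cong (A a b +_) (*-distribʳ-Σ (δ j b * m) (λ x → A a x * δ x k)) ⟨
  A a b + Σℤ (λ x → A a x * δ x k) * (δ j b * m)               ≡⟨ cong (λ z → A a b + z * (δ j b * m)) (Σ-δʳ k (A a)) ⟩
  A a b + A a k * (δ j b * m)                                  ∎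
  where open ≡-Reasoning

transvectionᵗ-· : ∀ {n} (A : Mat n) j k m a b →
  ((transvection j k m ᵗ) · A) a b ≡ A a b + δ j a * m * A k b
transvectionᵗ-· A j k m a b = begin
  Σℤ (λ x → (δ x a + δ x k * (δ j a * m)) * A x b)           ≡⟨ Σ-cong (λ x → ℤP.*-distribʳ-+ (A x b) (δ x a) _) ⟩
  Σℤ (λ x → δ x a * A x b + δ x k * (δ j a * m) * A x b)     ≡⟨ Σ-distrib-+ (λ x → δ x a * A x b) _ ⟩
  Σℤ (λ x → δ x a * A x b) + Σℤ (λ x → δ x k * (δ j a * m) * A x b)
    ≡⟨ cong₂ _+_ (Σ-δ a) (Σ-cong (λ x → rearrange (δ x k) (δ j a * m) (A x b))) ⟩
  A a b + Σℤ (λ x → δ j a * m * (δ x k * A x b))             ≡⟨ cong (A a b +_) (*-distribˡ-Σ (δ j a * m) (λ x → δ x k * A x b)) ⟨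
  A a b + δ j a * m * Σℤ (λ x → δ x k * A x b)               ≡⟨ cong (λ z → A a b + δ j a * m * z) (Σ-δ k) ⟩
  A a b + δ j a * m * A k b                                  ∎
  where
  open ≡-Reasoning
  Σ-δ : ∀ i → Σℤ (λ x → δ x i * A x b) ≡ A i b
  Σ-δ i = trans (Σ-cong (λ x → cong (_* A x b) (δ-sym x i))) (Σ-δˡ i (λ x → A x b))
  rearrange : ∀ p q r → p * q * r ≡ q * (p * r)
  rearrange = solve-∀

sandwich-transvection : ∀ {n} (G : Mat n) j k m a b → a ≢ j →
  sandwich (transvection j k m) G a b ≡ G a b + G a k * (δ j b * m)
sandwich-transvection G j k m a b a≢j = begin
  ((T ᵗ) · (G · T)) a b                        ≡⟨ transvectionᵗ-· (G · T) j k m a b ⟩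
  (G · T) a b + δ j a * m * (G · T) k b        ≡⟨ cong (λ z → (G · T) a b + z * m * (G · T) k b) (δ-off (≢-sym a≢j)) ⟩
  (G · T) a b + 0ℤ * m * (G · T) k b           ≡⟨ cong ((G · T) a b +_) (ℤP.*-zeroˡ ((G · T) k b)) ⟩
  (G · T) a b + 0ℤ                             ≡⟨ ℤP.+-identityʳ _ ⟩
  (G · T) a b                                  ≡⟨ ·-transvection G j k m a b ⟩
  G a b + G a k * (δ j b * m)                  ∎
  where
  open ≡-Reasoning
  T = transvection j k m

sandwich-transvection-target : ∀ {n} (G : Mat n) j k m a → a ≢ j →
  sandwich (transvection j k m) G a j ≡ G a j + G a k * m
sandwich-transvection-target G j k m a a≢j =
  trans (sandwich-transvection G j k m a j a≢j)
        (cong (λ z → G a j + G a k * z) (trans (cong (_* m) (δ-diag j)) (ℤP.*-identityˡ m)))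

sandwich-transvection-fixes : ∀ {n} (G : Mat n) j k m a b → a ≢ j → b ≢ j →
  sandwich (transvection j k m) G a b ≡ G a b
sandwich-transvection-fixes G j k m a b a≢j b≢j rewrite sandwich-transvection G j k m a b a≢j
  | δ-off (≢-sym b≢j) | ℤP.*-zeroˡ m | ℤP.*-zeroʳ (G a k) = ℤP.+-identityʳ (G a b)

transvection-inverses : ∀ {n} {j k : Fin n} m → j ≢ k →
  Inverses (transvection j k m) (transvection j k (- m))
transvection-inverses {j = j} {k} m j≢k = inverses (cancel m (- m) (ℤP.+-inverseʳ m)) (cancel (- m) m (ℤP.+-inverseˡ m))
  where
  cancel : ∀ p q → p + q ≡ 0ℤ → (transvection j k p · transvection j k q) ≋ I
  cancel p q p+q≡0 a b = begin
    (transvection j k p · transvection j k q) a b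
      ≡⟨ ·-transvection (transvection j k p) j k q a b ⟩
    (δ a b + δ a k * (δ j b * p)) + (δ a k + δ a k * (δ j k * p)) * (δ j b * q)
      ≡⟨ cong (λ z → (δ a b + δ a k * (δ j b * p)) + (δ a k + δ a k * (z * p)) * (δ j b * q)) (δ-off j≢k) ⟩
    (δ a b + δ a k * (δ j b * p)) + (δ a k + δ a k * (0ℤ * p)) * (δ j b * q)
      ≡⟨ collect (δ a b) (δ a k) (δ j b) p q ⟩
    δ a b + δ a k * δ j b * (p + q)
      ≡⟨ cong (λ z → δ a b + δ a k * δ j b * z) p+q≡0 ⟩
    δ a b + δ a k * δ j b * 0ℤ
      ≡⟨ cong (δ a b +_) (ℤP.*-zeroʳ (δ a k * δ j b)) ⟩
    δ a b + 0ℤ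
      ≡⟨ ℤP.+-identityʳ (δ a b) ⟩
    δ a b
      ≡⟨ I≡δ a b ⟨
    I a b ∎
    where
    open ≡-Reasoning
    collect : ∀ x y z p q → (x + y * (z * p)) + (y + y * (0ℤ * p)) * (z * q) ≡ x + y * z * (p + q)
    collect = solve-∀

record Reduction {c} (Z : Mat c) : Set where
  field
    form  : Mat c
    ∼form : Z ∼ form
    skew  : SkewSymmetric form

open Reduction

initial : ∀ {c} {Z : Mat c} → SkewSymmetric Z → Reduction Z
initial {Z = Z} skew = record { form = Z ; ∼form = ≋⇒∼ ≋-refl ; skew = skew }

transvect : ∀ {c} {Z : Mat c} (j k : Fin c) → j ≢ k → ℤ → Reduction Z → Reduction Z
transvect j k j≢k m R = record
  { form  = sandwich (transvection j k m) (form R)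
  ; ∼form = ∼-trans (∼form R) (∼-sandwich (transvection-inverses m j≢k) (form R))
  ; skew  = skew-sandwich (transvection j k m) (skew R)
  }

-- Up to sign, swaps the basis vectors k and j.
exchange : ∀ {c} {Z : Mat c} (k j : Fin c) → k ≢ j → Reduction Z → Reduction Z
exchange k j k≢j R = transvect k j k≢j 1ℤ (transvect j k (≢-sym k≢j) (- 1ℤ) (transvect k j k≢j 1ℤ R))

exchange-column : ∀ {c} {Z : Mat c} (k j : Fin c) (k≢j : k ≢ j) (R : Reduction Z) x → x ≢ k → x ≢ j →
  form (exchange k j k≢j R) x k ≡ form R x j
exchange-column k j k≢j R x x≢k x≢j = finish
  (sandwich-transvection-target (form R₂) k j 1ℤ x x≢k)
  (sandwich-transvection-fixes (form R₁) j k (- 1ℤ) x k x≢j k≢j)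
  (sandwich-transvection-target (form R₁) j k (- 1ℤ) x x≢j)
  (sandwich-transvection-target (form R) k j 1ℤ x x≢k)
  (sandwich-transvection-fixes (form R) k j 1ℤ x j x≢k (≢-sym k≢j))
  where
  R₁ = transvect k j k≢j 1ℤ R
  R₂ = transvect j k (≢-sym k≢j) (- 1ℤ) R₁
  finish : ∀ {g₃ g₂k g₂j g₁k g₁j} → g₃ ≡ g₂k + g₂j * 1ℤ → g₂k ≡ g₁k → g₂j ≡ g₁j + g₁k * - 1ℤ →
    g₁k ≡ form R x k + form R x j * 1ℤ → g₁j ≡ form R x j → g₃ ≡ form R x j
  finish refl refl refl refl refl = cancel (form R x k) (form R x j)
    where
    cancel : ∀ a b → a + b * 1ℤ + (b + (a + b * 1ℤ) * - 1ℤ) * 1ℤ ≡ b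
    cancel = solve-∀

KeepsOutside : ∀ {c} {Z : Mat c} → Fin c → Reduction Z → Reduction Z → Set
KeepsOutside j R R′ = ∀ x y → x ≢ j → y ≢ j → form R′ x y ≡ form R x y

record Remainder {c} {Z : Mat c} (R : Reduction Z) (a b j : Fin c) : Set where
  constructor divided
  field
    reduced         : Reduction Z
    remainder       : ℕ
    remainder-entry : form reduced a j ≡ ℤ.+ remainder
    remainder-<     : remainder ℕ.< ∣ form R a b ∣
    keeps-row       : form reduced b j ≡ form R b j
    keeps-outside   : KeepsOutside j R reduced

-- Subtract (a, j) / (a, b) times column b from column j; entry (b, j) survives because
-- (b, b) is 0.
divideEntry : ∀ {c} {Z : Mat c} (R : Reduction Z) {a b j : Fin c} → a ≢ j → b ≢ j →
  form R a b ≢ 0ℤ → Remainder R a b j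
divideEntry R {a} {b} {j} a≢j b≢j nz = record
  { reduced         = R′
  ; remainder       = G a j ℤ.% G a b
  ; remainder-entry = trans (sandwich-transvection-target G j b (- q) a a≢j)
                            (remainder-identity (ℤDM.a≡a%n+[a/n]*n (G a j) (G a b)))
  ; remainder-<     = ℤDM.n%d<d (G a j) (G a b)
  ; keeps-row       = trans (sandwich-transvection-target G j b (- q) b b≢j)
                            (trans (cong (λ z → G b j + z * - q) (skew-diag (skew R) b))
                                   (ℤP.+-identityʳ (G b j)))
  ; keeps-outside   = λ x y x≢j y≢j → sandwich-transvection-fixes G j b (- q) x y x≢j y≢j
  }
  where
  instance _ = ℤ.≢-nonZero nz
  G  = form R
  q  = G a j ℤ./ G a b
  R′ = transvect j b (≢-sym b≢j) (- q) R
  remainder-identity : ∀ {x r d} → x ≡ ℤ.+ r + q * d → x + d * - q ≡ ℤ.+ r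
  remainder-identity {r = r} {d} refl = cancel (ℤ.+ r) q d
    where
    cancel : ∀ x q d → x + q * d + d * - q ≡ x
    cancel = solve-∀

keepsOutside-trans : ∀ {c} {Z : Mat c} {j : Fin c} {R R′ R″ : Reduction Z} →
  KeepsOutside j R R′ → KeepsOutside j R′ R″ → KeepsOutside j R R″
keepsOutside-trans k k′ x y x≢j y≢j = trans (k′ x y x≢j y≢j) (k x y x≢j y≢j)

module Pivoting {n : ℕ} {Z : Mat (2 ℕ.+ n)} where

  pivot : Reduction Z → ℤ
  pivot R = form R 0F 1F

  Clean : Reduction Z → Fin n → Set
  Clean R t = (form R 0F (2 ↑ʳ t) ≡ 0ℤ) × (form R 1F (2 ↑ʳ t) ≡ 0ℤ)

  record Smaller (R : Reduction Z) : Set where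
    constructor shrunk
    field
      next         : Reduction Z
      next-nonzero : pivot next ≢ 0ℤ
      next-<       : ∣ pivot next ∣ ℕ.< ∣ pivot R ∣

  data ColumnStep (R : Reduction Z) (t : Fin n) : Set where
    cleared : (R′ : Reduction Z) → Clean R′ t → KeepsOutside (2 ↑ʳ t) R R′ → ColumnStep R t
    smaller : Smaller R → ColumnStep R t

  smallerPivot : ∀ {R t} (R′ : Reduction Z) {r : ℕ} → ∣ pivot R′ ∣ ≡ r → r ≢ 0 → r ℕ.< ∣ pivot R ∣ →
    ColumnStep R t
  smallerPivot R′ ∣p∣≡r r≢0 r< =
    smaller (shrunk R′ (λ p≡0 → r≢0 (trans (sym ∣p∣≡r) (cong ∣_∣ p≡0))) (subst (ℕ._< _) (sym ∣p∣≡r) r<))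

  -- Reduce the entries of column t in rows 0 and 1 modulo the pivot; a nonzero remainder
  -- is exchanged into the pivot position.
  clearColumn : (R : Reduction Z) → pivot R ≢ 0ℤ → (t : Fin n) → ColumnStep R t
  clearColumn R nz t = row0 (divideEntry R (λ ()) (λ ()) nz)
    where
    j = 2 ↑ʳ t
    row0 : Remainder R 0F 1F j → ColumnStep R t
    row0 (divided R₁ r₁ e₁ r₁< _ out₁) with r₁ ℕ.≟ 0
    ... | no r₁≢0 = smallerPivot (exchange 1F j (λ ()) R₁)
                      (cong ∣_∣ (trans (exchange-column 1F j (λ ()) R₁ 0F (λ ()) (λ ())) e₁)) r₁≢0 r₁<
    ... | yes r₁≡0 = row1 (divideEntry R₁ (λ ()) (λ ()) pivot₁≢0)
      where
      pivot₁ : form R₁ 1F 0F ≡ - pivot R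
      pivot₁ = trans (skew R₁ 0F 1F) (cong -_ (out₁ 0F 1F (λ ()) (λ ())))
      pivot₁≢0 : form R₁ 1F 0F ≢ 0ℤ
      pivot₁≢0 e = nz (ℤP.neg-injective (trans (sym pivot₁) e))
      row1 : Remainder R₁ 1F 0F j → ColumnStep R t
      row1 (divided R₂ r₂ e₂ r₂< row₂ out₂) with r₂ ℕ.≟ 0
      ... | yes r₂≡0 = cleared R₂ (trans row₂ (trans e₁ (cong ℤ.+_ r₁≡0)) , trans e₂ (cong ℤ.+_ r₂≡0))
                                  (keepsOutside-trans {R = R} {R₁} {R₂} out₁ out₂)
      ... | no r₂≢0 = smallerPivot R₃ ∣pivot₃∣ r₂≢0
                        (subst (r₂ ℕ.<_) (trans (cong ∣_∣ pivot₁) (ℤP.∣-i∣≡∣i∣ (pivot R))) r₂<)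
        where
        R₃ = exchange 0F j (λ ()) R₂
        ∣pivot₃∣ : ∣ pivot R₃ ∣ ≡ r₂
        ∣pivot₃∣ = begin
          ∣ form R₃ 0F 1F ∣     ≡⟨ cong ∣_∣ (skew R₃ 1F 0F) ⟩
          ∣ - form R₃ 1F 0F ∣   ≡⟨ ℤP.∣-i∣≡∣i∣ (form R₃ 1F 0F) ⟩
          ∣ form R₃ 1F 0F ∣     ≡⟨ cong ∣_∣ (trans (exchange-column 0F j (λ ()) R₂ 1F (λ ()) (λ ())) e₂) ⟩
          r₂                    ∎
          where open ≡-Reasoning

  AllClean : Reduction Z → Set
  AllClean R = ∀ t → Clean R t

  Cleaned : Reduction Z → Set
  Cleaned R = ∃ λ R′ → pivot R′ ≡ pivot R × AllClean R′

  sweep : (L : List (Fin n)) (R : Reduction Z) → pivot R ≢ 0ℤ → (∀ t → t ∈ L ⊎ Clean R t) →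
    Cleaned R ⊎ Smaller R
  sweep []      R nz pending = inj₁ (R , refl , λ t → Sum.[ (λ ()) , id ] (pending t))
  sweep (t ∷ L) R nz pending = continue (clearColumn R nz t)
    where
    continue : ColumnStep R t → Cleaned R ⊎ Smaller R
    continue (smaller s) = inj₂ s
    continue (cleared R′ clean keeps) =
      Sum.map (λ (R″ , same , clean″) → R″ , trans same same-pivot , clean″)
              (λ (shrunk N nzN N<) → shrunk N nzN (subst (λ p → ∣ pivot N ∣ ℕ.< ∣ p ∣) same-pivot N<))
              (sweep L R′ (λ e → nz (trans (sym same-pivot) e)) pending′)
      where
      same-pivot : pivot R′ ≡ pivot R
      same-pivot = keeps 0F 1F (λ ()) (λ ())
      pending′ : ∀ t′ → t′ ∈ L ⊎ Clean R′ t′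
      pending′ t′ with t′ Fin.≟ t
      ... | yes refl = inj₂ clean
      ... | no t′≢t = Sum.map drop-t keep-clean (pending t′)
        where
        drop-t : t′ ∈ t ∷ L → t′ ∈ L
        drop-t (here t′≡t) = ⊥-elim (t′≢t t′≡t)
        drop-t (there t′∈L) = t′∈L
        j≢ : 2 ↑ʳ t′ ≢ 2 ↑ʳ t
        j≢ e = t′≢t (FinP.↑ʳ-injective 2 t′ t e)
        keep-clean : Clean R t′ → Clean R′ t′
        keep-clean (c₀ , c₁) = trans (keeps 0F _ (λ ()) j≢) c₀ , trans (keeps 1F _ (λ ()) j≢) c₁

  record Split : Set where
    field
      reduction : Reduction Z
      nonzero   : pivot reduction ≢ 0ℤ
      clean     : AllClean reduction

  euclid : (R : Reduction Z) → pivot R ≢ 0ℤ → Acc ℕ._<_ ∣ pivot R ∣ → Split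
  euclid R nz (acc rec) with sweep (allFin n) R nz (λ t → inj₁ (∈-allFin t))
  ... | inj₁ (R′ , same , clean) = record { reduction = R′ ; nonzero = λ e → nz (trans (sym same) e) ; clean = clean }
  ... | inj₂ (shrunk R′ nz′ R′<) = euclid R′ nz′ (rec R′<)

  Pivoted : Set
  Pivoted = ∃ λ (R : Reduction Z) → pivot R ≢ 0ℤ

  pivotFromRow0 : (R : Reduction Z) (j : Fin (2 ℕ.+ n)) → form R 0F j ≢ 0ℤ → Pivoted
  pivotFromRow0 R 0F            nz = ⊥-elim (nz (skew-diag (skew R) 0F))
  pivotFromRow0 R 1F            nz = R , nz
  pivotFromRow0 R (suc (suc t)) nz =
    exchange 1F j (λ ()) R , λ e → nz (trans (sym (exchange-column 1F j (λ ()) R 0F (λ ()) (λ ()))) e)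
    where j = 2 ↑ʳ t

  -- If row 0 vanishes at column j, adding row and column i to row and column 0 brings
  -- the nonzero entry (i, j) into row 0.
  findPivot : (R : Reduction Z) (i j : Fin (2 ℕ.+ n)) → form R i j ≢ 0ℤ → Pivoted
  findPivot R 0F      j  nz = pivotFromRow0 R j nz
  findPivot R (suc i) 0F nz = pivotFromRow0 R (suc i) (skew-≢0 (skew R) nz)
  findPivot R (suc i) (suc j) nz with form R 0F (suc j) ℤ.≟ 0ℤ
  ... | no  nz′ = pivotFromRow0 R (suc j) nz′
  ... | yes z   = pivotFromRow0 R′ (suc j) (skew-≢0 {i = suc j} {0F} (skew R′) nz′)
    where
    R′ = transvect 0F (suc i) (λ ()) 1ℤ R
    entry : form R′ (suc j) 0F ≡ form R (suc j) (suc i)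
    entry = begin
      form R′ (suc j) 0F                                     ≡⟨ sandwich-transvection-target (form R) 0F (suc i) 1ℤ (suc j) (λ ()) ⟩
      form R (suc j) 0F + form R (suc j) (suc i) * 1ℤ        ≡⟨ cong (_+ form R (suc j) (suc i) * 1ℤ) (trans (skew R 0F (suc j)) (cong -_ z)) ⟩
      0ℤ + form R (suc j) (suc i) * 1ℤ                       ≡⟨ trans (ℤP.+-identityˡ _) (ℤP.*-identityʳ _) ⟩
      form R (suc j) (suc i)                                 ∎
      where open ≡-Reasoning
    nz′ : form R′ (suc j) 0F ≢ 0ℤ
    nz′ e = skew-≢0 (skew R) nz (trans (sym entry) e)

infixr 6 _⊞_
_⊞_ : ∀ {n} → Mat 2 → Mat n → Mat (2 ℕ.+ n)
(A ⊞ B) 0F            0F            = A 0F 0F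
(A ⊞ B) 0F            1F            = A 0F 1F
(A ⊞ B) 0F            (suc (suc j)) = 0ℤ
(A ⊞ B) 1F            0F            = A 1F 0F
(A ⊞ B) 1F            1F            = A 1F 1F
(A ⊞ B) 1F            (suc (suc j)) = 0ℤ
(A ⊞ B) (suc (suc i)) 0F            = 0ℤ
(A ⊞ B) (suc (suc i)) 1F            = 0ℤ
(A ⊞ B) (suc (suc i)) (suc (suc j)) = B i j

⊞-cong : ∀ {n} {A A′ : Mat 2} {B B′ : Mat n} → A ≋ A′ → B ≋ B′ → (A ⊞ B) ≋ (A′ ⊞ B′)
⊞-cong e f 0F            0F            = e 0F 0F
⊞-cong e f 0F            1F            = e 0F 1F
⊞-cong e f 0F            (suc (suc j)) = refl
⊞-cong e f 1F            0F            = e 1F 0F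
⊞-cong e f 1F            1F            = e 1F 1F
⊞-cong e f 1F            (suc (suc j)) = refl
⊞-cong e f (suc (suc i)) 0F            = refl
⊞-cong e f (suc (suc i)) 1F            = refl
⊞-cong e f (suc (suc i)) (suc (suc j)) = f i j

ᵗ-⊞ : ∀ {n} (A : Mat 2) (B : Mat n) → ((A ⊞ B) ᵗ) ≋ ((A ᵗ) ⊞ (B ᵗ))
ᵗ-⊞ A B 0F            0F            = refl
ᵗ-⊞ A B 0F            1F            = refl
ᵗ-⊞ A B 0F            (suc (suc j)) = refl
ᵗ-⊞ A B 1F            0F            = refl
ᵗ-⊞ A B 1F            1F            = refl
ᵗ-⊞ A B 1F            (suc (suc j)) = refl
ᵗ-⊞ A B (suc (suc i)) 0F            = refl
ᵗ-⊞ A B (suc (suc i)) 1F            = refl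
ᵗ-⊞ A B (suc (suc i)) (suc (suc j)) = refl

leading-zeros : ∀ x → 0ℤ + (0ℤ + x) ≡ x
leading-zeros x = trans (ℤP.+-identityˡ _) (ℤP.+-identityˡ x)

two-terms : ∀ {n} x y → x + (y + Σℤ {n} (λ _ → 0ℤ)) ≡ x + (y + 0ℤ)
two-terms {n} x y = cong (λ z → x + (y + z)) (Σ-zero {n} (λ _ → refl))

vanishing-terms : ∀ {n} a b {f : Fin n → ℤ} → (∀ t → f t ≡ 0ℤ) → a * 0ℤ + (b * 0ℤ + Σℤ f) ≡ 0ℤ
vanishing-terms a b f≡0 = cong₂ _+_ (ℤP.*-zeroʳ a) (cong₂ _+_ (ℤP.*-zeroʳ b) (Σ-zero f≡0))

⊞-· : ∀ {n} (A C : Mat 2) (B D : Mat n) → ((A ⊞ B) · (C ⊞ D)) ≋ ((A · C) ⊞ (B · D))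
⊞-· {n} A C B D 0F            0F            = two-terms {n} (A 0F 0F * C 0F 0F) (A 0F 1F * C 1F 0F)
⊞-· {n} A C B D 0F            1F            = two-terms {n} (A 0F 0F * C 0F 1F) (A 0F 1F * C 1F 1F)
⊞-· {n} A C B D 0F            (suc (suc j)) = vanishing-terms {n} (A 0F 0F) (A 0F 1F) (λ _ → refl)
⊞-· {n} A C B D 1F            0F            = two-terms {n} (A 1F 0F * C 0F 0F) (A 1F 1F * C 1F 0F)
⊞-· {n} A C B D 1F            1F            = two-terms {n} (A 1F 0F * C 0F 1F) (A 1F 1F * C 1F 1F)
⊞-· {n} A C B D 1F            (suc (suc j)) = vanishing-terms {n} (A 1F 0F) (A 1F 1F) (λ _ → refl)
⊞-· {n} A C B D (suc (suc i)) 0F            = trans (leading-zeros _) (Σ-zero (λ t → ℤP.*-zeroʳ (B i t)))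
⊞-· {n} A C B D (suc (suc i)) 1F            = trans (leading-zeros _) (Σ-zero (λ t → ℤP.*-zeroʳ (B i t)))
⊞-· {n} A C B D (suc (suc i)) (suc (suc j)) = leading-zeros _

I⊞I : ∀ {n} → (I ⊞ I {n}) ≋ I
I⊞I 0F            0F            = refl
I⊞I 0F            1F            = refl
I⊞I 0F            (suc (suc j)) = refl
I⊞I 1F            0F            = refl
I⊞I 1F            1F            = refl
I⊞I 1F            (suc (suc j)) = refl
I⊞I (suc (suc i)) 0F            = refl
I⊞I (suc (suc i)) 1F            = refl
I⊞I (suc (suc i)) (suc (suc j)) = trans (I≡δ i j) (sym (I≡δ (suc (suc i)) (suc (suc j))))

inverses-⊞ : ∀ {n} {Q Q⁻¹ : Mat n} → Inverses Q Q⁻¹ → Inverses (I ⊞ Q) (I ⊞ Q⁻¹)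
inverses-⊞ {Q = Q} {Q⁻¹} (inverses QQ⁻¹ Q⁻¹Q) = inverses
  (≋-trans (⊞-· I I Q Q⁻¹) (≋-trans (⊞-cong (·-identityˡ I) QQ⁻¹) I⊞I))
  (≋-trans (⊞-· I I Q⁻¹ Q) (≋-trans (⊞-cong (·-identityˡ I) Q⁻¹Q) I⊞I))

sandwich-⊞ : ∀ {n} (P A : Mat 2) (Q B : Mat n) → sandwich (P ⊞ Q) (A ⊞ B) ≋ (sandwich P A ⊞ sandwich Q B)
sandwich-⊞ P A Q B =
  ≋-trans (·-cong (ᵗ-⊞ P Q) (⊞-· A P B Q)) (⊞-· (P ᵗ) (A · P) (Q ᵗ) (B · Q))

∼-⊞ : ∀ {n} (A : Mat 2) {X Y : Mat n} → X ∼ Y → (A ⊞ X) ∼ (A ⊞ Y)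
∼-⊞ A {Y = Y} (congruent Q Q⁻¹ invQ eQ) =
  congruent (I ⊞ Q) (I ⊞ Q⁻¹) (inverses-⊞ invQ)
    (≋-trans (⊞-cong (≋-sym (sandwich-I A)) eQ) (≋-sym (sandwich-⊞ I A Q Y)))

hyperbolic : ℤ → Mat 2
hyperbolic d 0F 0F = 0ℤ
hyperbolic d 0F 1F = d
hyperbolic d 1F 0F = - d
hyperbolic d 1F 1F = 0ℤ

O : ∀ {c} → Mat c
O _ _ = 0ℤ

data SkewForm : ℕ → Set where
  zero-form : ∀ {c} → SkewForm c
  _∷_       : ∀ {c} → ℤ → SkewForm c → SkewForm (2 ℕ.+ c)

matrix : ∀ {c} → SkewForm c → Mat c
matrix zero-form = O
matrix (d ∷ s)   = hyperbolic d ⊞ matrix s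

AllBlocks : ∀ {c} → (ℤ → Set) → SkewForm c → Set
AllBlocks P zero-form = ⊤
AllBlocks P (d ∷ s)   = P d × AllBlocks P s

open Pivoting

lowerRight : ∀ {n} → Mat (2 ℕ.+ n) → Mat n
lowerRight G i j = G (2 ↑ʳ i) (2 ↑ʳ j)

clean⇒split : ∀ {n} {Z : Mat (2 ℕ.+ n)} (R : Reduction Z) → AllClean R → form R ≋ (hyperbolic (pivot R) ⊞ lowerRight (form R))
clean⇒split R clean 0F            0F            = skew-diag (skew R) 0F
clean⇒split R clean 0F            1F            = refl
clean⇒split R clean 0F            (suc (suc j)) = proj₁ (clean j)
clean⇒split R clean 1F            0F            = skew R 0F 1F
clean⇒split R clean 1F            1F            = skew-diag (skew R) 1F
clean⇒split R clean 1F            (suc (suc j)) = proj₂ (clean j)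
clean⇒split R clean (suc (suc i)) 0F            = trans (skew R 0F (2 ↑ʳ i)) (cong -_ (proj₁ (clean i)))
clean⇒split R clean (suc (suc i)) 1F            = trans (skew R 1F (2 ↑ʳ i)) (cong -_ (proj₂ (clean i)))
clean⇒split R clean (suc (suc i)) (suc (suc j)) = refl

zero-or-nonzero : ∀ {c} (Z : Mat c) → (Z ≋ O) ⊎ ∃ λ i → ∃ λ j → Z i j ≢ 0ℤ
zero-or-nonzero Z with FinP.all? (λ i → FinP.all? (λ j → Z i j ℤ.≟ 0ℤ))
... | yes Z≋O = inj₁ Z≋O
... | no Z≉O with FinP.¬∀⟶∃¬ _ _ (λ i → FinP.all? (λ j → Z i j ℤ.≟ 0ℤ)) Z≉O
... | i , row≉0 = inj₂ (i , FinP.¬∀⟶∃¬ _ _ (λ j → Z i j ℤ.≟ 0ℤ) row≉0)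

NormalForm : ∀ {c} → Mat c → Set
NormalForm {c} Z = ∃ λ (s : SkewForm c) → AllBlocks (_≢ 0ℤ) s × Z ∼ matrix s

normalForm : ∀ c (Z : Mat c) → SkewSymmetric Z → NormalForm Z
normalForm 0             Z skewZ = zero-form , tt , ≋⇒∼ (λ ())
normalForm 1             Z skewZ = zero-form , tt , ≋⇒∼ (λ { 0F 0F → skew-diag skewZ 0F })
normalForm (suc (suc n)) Z skewZ with zero-or-nonzero Z
... | inj₁ Z≋O = zero-form , tt , ≋⇒∼ Z≋O
... | inj₂ (i , j , Zij≢0) = normalize (euclid R nz (<-wellFounded _))
  where
  R  = proj₁ (findPivot (initial skewZ) i j Zij≢0)
  nz = proj₂ (findPivot (initial skewZ) i j Zij≢0)
  normalize : Split → NormalForm Z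
  normalize record { reduction = R′ ; nonzero = nz′ ; clean = clean } =
    let s , nonzero , Z′∼s = normalForm n (lowerRight (form R′)) (λ a b → skew R′ (2 ↑ʳ a) (2 ↑ʳ b))
    in pivot R′ ∷ s , (nz′ , nonzero) ,
       ∼-trans (∼form R′) (∼-trans (≋⇒∼ (clean⇒split R′ clean)) (∼-⊞ (hyperbolic (pivot R′)) Z′∼s))

-- Invertibility and purity

≐-setoid : ℕ → Setoid _ _
≐-setoid c = record
  { Carrier = Vecℤ c ; _≈_ = _≐_
  ; isEquivalence = record { refl = λ _ → refl ; sym = λ e i → sym (e i) ; trans = λ e f i → trans (e i) (f i) } }

▷-cong : ∀ {c} {A B : Mat c} {x y : Vecℤ c} → A ≋ B → x ≐ y → (A ▷ x) ≐ (B ▷ y)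
▷-cong e f i = Σ-cong (λ k → cong₂ _*_ (e i k) (f k))

▷-congˡ : ∀ {c} (A : Mat c) {x y : Vecℤ c} → x ≐ y → (A ▷ x) ≐ (A ▷ y)
▷-congˡ A = ▷-cong {A = A} ≋-refl

▷-· : ∀ {c} (A B : Mat c) (x : Vecℤ c) → ((A · B) ▷ x) ≐ (A ▷ (B ▷ x))
▷-· A B x i = ·-assoc A B (λ k _ → x k) i i

▷-⋆ : ∀ {c} (A : Mat c) a (x : Vecℤ c) → (A ▷ (a ⋆ x)) ≐ (a ⋆ (A ▷ x))
▷-⋆ A a x i = trans (Σ-cong (λ k → swap-factors (A i k) a (x k))) (sym (*-distribˡ-Σ a (λ k → A i k * x k)))
  where
  swap-factors : ∀ p q r → p * (q * r) ≡ q * (p * r)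
  swap-factors = solve-∀

▷-cancel : ∀ {c} (A B : Mat c) → (A · B) ≋ I → ∀ x → (A ▷ (B ▷ x)) ≐ x
▷-cancel A B AB x i = begin
  (A ▷ (B ▷ x)) i     ≡⟨ ▷-· A B x i ⟨
  ((A · B) ▷ x) i     ≡⟨ ▷-cong AB (λ _ → refl) i ⟩
  (I ▷ x) i           ≡⟨ Σ-cong (λ k → cong (_* x k) (I≡δ i k)) ⟩
  Σℤ (λ k → δ i k * x k) ≡⟨ Σ-δˡ i x ⟩
  x i                 ∎
  where open ≡-Reasoning

invertible-resp-≋ : ∀ {c} {A B : Mat c} → A ≋ B → ZInvertible A → ZInvertible B
invertible-resp-≋ {A = A} {B} e (V , AV , VA) =
  V , ≋-trans (·-cong {A = B} {A} {V} (≋-sym e) ≋-refl) AV , ≋-trans (·-cong {A = V} {V} {B} {A} ≋-refl (≋-sym e)) VA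

inverses⇒invertible : ∀ {c} {P P⁻¹ : Mat c} → Inverses P P⁻¹ → ZInvertible P
inverses⇒invertible {P⁻¹ = P⁻¹} (inverses PP⁻¹ P⁻¹P) = P⁻¹ , PP⁻¹ , P⁻¹P

invertible⇒inverses : ∀ {c} {A : Mat c} (invA : ZInvertible A) → Inverses A (proj₁ invA)
invertible⇒inverses (_ , AA⁻¹ , A⁻¹A) = inverses AA⁻¹ A⁻¹A

invertible-· : ∀ {c} {A B : Mat c} → ZInvertible A → ZInvertible B → ZInvertible (A · B)
invertible-· invA invB =
  inverses⇒invertible (inverses-· (invertible⇒inverses invB) (invertible⇒inverses invA))

invertible-resp-∼ : ∀ {c} {W D : Mat c} → W ∼ D → ZInvertible W → ZInvertible D
invertible-resp-∼ W∼D invW with ∼-sym W∼D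
... | congruent P P⁻¹ invP eP =
  invertible-resp-≋ (≋-sym eP) (invertible-· (inverses⇒invertible (inverses-ᵗ invP)) (invertible-· invW (inverses⇒invertible invP)))

pure-resp-≋ : ∀ {c} {A B : Mat c} → A ≋ B → Pure A → Pure B
pure-resp-≋ e pureA a x a≢0 (y , By≐ax) with pureA a x a≢0 (y , λ i → trans (▷-cong e (λ _ → refl) i) (By≐ax i))
... | z , Az≐x = z , λ i → trans (▷-cong (≋-sym e) (λ _ → refl) i) (Az≐x i)

-- Multiplying on the right by an invertible matrix does not change the image.
pure-·ʳ : ∀ {c} {W P P⁻¹ : Mat c} → Inverses P P⁻¹ → Pure W → Pure (W · P)
pure-·ʳ {c} {W} {P} {P⁻¹} (inverses PP⁻¹ _) pureW a x a≢0 (y , WPy≐ax)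
  with pureW a x a≢0 (P ▷ y , λ i → trans (sym (▷-· W P y i)) (WPy≐ax i))
... | z , Wz≐x = P⁻¹ ▷ z , λ i → begin
  ((W · P) ▷ (P⁻¹ ▷ z)) i   ≡⟨ ▷-· W P (P⁻¹ ▷ z) i ⟩
  (W ▷ (P ▷ (P⁻¹ ▷ z))) i   ≡⟨ ▷-congˡ W (▷-cancel P P⁻¹ PP⁻¹ z) i ⟩
  (W ▷ z) i                 ≡⟨ Wz≐x i ⟩
  x i                       ∎
  where open ≡-Reasoning

-- An automorphism of ℤ^c carries the pure image of W onto the image of A · W.
pure-·ˡ : ∀ {c} {W A : Mat c} → ZInvertible A → Pure W → Pure (A · W)
pure-·ˡ {c} {W} {A} (A⁻¹ , AA⁻¹ , A⁻¹A) pureW a x a≢0 (y , AWy≐ax)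
  with pureW a (A⁻¹ ▷ x) a≢0 (y , Wy≐aA⁻¹x)
  where
  Wy≐aA⁻¹x : (W ▷ y) ≐ (a ⋆ (A⁻¹ ▷ x))
  Wy≐aA⁻¹x = begin
    W ▷ y                  ≈⟨ ▷-cancel A⁻¹ A A⁻¹A (W ▷ y) ⟨
    A⁻¹ ▷ (A ▷ (W ▷ y))    ≈⟨ ▷-congˡ A⁻¹ (λ i → trans (sym (▷-· A W y i)) (AWy≐ax i)) ⟩
    A⁻¹ ▷ (a ⋆ x)          ≈⟨ ▷-⋆ A⁻¹ a x ⟩
    a ⋆ (A⁻¹ ▷ x)          ∎
    where open SetoidReasoning (≐-setoid c)
... | z , Wz≐A⁻¹x = z , λ i → begin
  ((A · W) ▷ z) i         ≡⟨ ▷-· A W z i ⟩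
  (A ▷ (W ▷ z)) i         ≡⟨ ▷-congˡ A Wz≐A⁻¹x i ⟩
  (A ▷ (A⁻¹ ▷ x)) i       ≡⟨ ▷-cancel A A⁻¹ AA⁻¹ x i ⟩
  x i                     ∎
  where open ≡-Reasoning

pure-resp-∼ : ∀ {c} {W D : Mat c} → W ∼ D → Pure W → Pure D
pure-resp-∼ {W = W} W∼D pureW with ∼-sym W∼D
... | congruent P P⁻¹ invP eP =
  pure-resp-≋ (≋-sym eP) (pure-·ˡ (inverses⇒invertible (inverses-ᵗ invP)) (pure-·ʳ {W = W} invP pureW))

IsUnit : ℤ → Set
IsUnit d = d * d ≡ 1ℤ

*≡1⇒unit : ∀ d y → d * y ≡ 1ℤ → IsUnit d
*≡1⇒unit d y dy≡1 = ∣d∣≡1⇒unit d (ℕP.m*n≡1⇒m≡1 ∣ d ∣ ∣ y ∣ (trans (sym (ℤP.abs-* d y)) (cong ∣_∣ dy≡1)))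
  where
  ∣d∣≡1⇒unit : ∀ d → ∣ d ∣ ≡ 1 → IsUnit d
  ∣d∣≡1⇒unit (ℤ.+ 1)    _ = refl
  ∣d∣≡1⇒unit ℤ.-[1+ 0 ] _ = refl

UnitForm : ∀ {c} → SkewForm c → Set
UnitForm (zero-form {c}) = c ≡ 0
UnitForm (d ∷ s)         = IsUnit d × UnitForm s

lowerRight-I : ∀ {n} → lowerRight (I {2 ℕ.+ n}) ≋ I
lowerRight-I i j = trans (I≡δ (2 ↑ʳ i) (2 ↑ʳ j)) (sym (I≡δ i j))

lowerRight-⊞-· : ∀ {n} (A : Mat 2) (B : Mat n) X → lowerRight ((A ⊞ B) · X) ≋ (B · lowerRight X)
lowerRight-⊞-· A B X i j = leading-zeros _

lowerRight-·-⊞ : ∀ {n} X (A : Mat 2) (B : Mat n) → lowerRight (X · (A ⊞ B)) ≋ (lowerRight X · B)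
lowerRight-·-⊞ X A B i j =
  trans (cong₂ _+_ (ℤP.*-zeroʳ (X (2 ↑ʳ i) 0F)) (cong₂ _+_ (ℤP.*-zeroʳ (X (2 ↑ʳ i) 1F)) refl)) (leading-zeros _)

invertible-lowerRight : ∀ {n} (A : Mat 2) (B : Mat n) → ZInvertible (A ⊞ B) → ZInvertible B
invertible-lowerRight A B (X , AX≋I , XA≋I) =
  lowerRight X ,
  ≋-trans (≋-sym (lowerRight-⊞-· A B X)) (≋-trans (λ i j → AX≋I (2 ↑ʳ i) (2 ↑ʳ j)) lowerRight-I) ,
  ≋-trans (≋-sym (lowerRight-·-⊞ X A B)) (≋-trans (λ i j → XA≋I (2 ↑ʳ i) (2 ↑ʳ j)) lowerRight-I)

hyperbolic-⊞-row0 : ∀ {n} d (B : Mat n) (y : Vecℤ (2 ℕ.+ n)) → ((hyperbolic d ⊞ B) ▷ y) 0F ≡ d * y 1F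
hyperbolic-⊞-row0 {n} d B y =
  trans (ℤP.+-identityˡ _) (trans (cong (d * y 1F +_) (Σ-zero {n} (λ _ → refl))) (ℤP.+-identityʳ _))

invertible-hyperbolic : ∀ {n} d (B : Mat n) → ZInvertible (hyperbolic d ⊞ B) → IsUnit d
invertible-hyperbolic d B (X , AX≋I , _) =
  *≡1⇒unit d (X 1F 0F) (trans (sym (hyperbolic-⊞-row0 d B (λ k → X k 0F))) (AX≋I 0F 0F))

invertible⇒unitForm : ∀ {c} (s : SkewForm c) → ZInvertible (matrix s) → UnitForm s
invertible⇒unitForm (zero-form {0})     _             = refl
invertible⇒unitForm (zero-form {suc c}) (X , OX≋I , _) = ⊥-elim (0≢1 (trans (sym (Σ-zero {suc c} (λ _ → refl))) (OX≋I 0F 0F)))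
  where
  0≢1 : 0ℤ ≢ 1ℤ
  0≢1 ()
invertible⇒unitForm (d ∷ s) invW =
  invertible-hyperbolic d (matrix s) invW , invertible⇒unitForm s (invertible-lowerRight (hyperbolic d) (matrix s) invW)

pad : ∀ {n} → Vecℤ n → Vecℤ (2 ℕ.+ n)
pad y 0F            = 0ℤ
pad y 1F            = 0ℤ
pad y (suc (suc i)) = y i

▷-pad : ∀ {n} (A : Mat 2) (B : Mat n) y → ((A ⊞ B) ▷ pad y) ≐ pad (B ▷ y)
▷-pad {n} A B y 0F            = vanishing-terms {n} (A 0F 0F) (A 0F 1F) (λ _ → refl)
▷-pad {n} A B y 1F            = vanishing-terms {n} (A 1F 0F) (A 1F 1F) (λ _ → refl)
▷-pad     A B y (suc (suc i)) = leading-zeros _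

pad-⋆ : ∀ {n} a (x : Vecℤ n) → pad (a ⋆ x) ≐ (a ⋆ pad x)
pad-⋆ a x 0F            = sym (ℤP.*-zeroʳ a)
pad-⋆ a x 1F            = sym (ℤP.*-zeroʳ a)
pad-⋆ a x (suc (suc i)) = refl

pure-lowerRight : ∀ {n} (A : Mat 2) (B : Mat n) → Pure (A ⊞ B) → Pure B
pure-lowerRight A B pureAB a x a≢0 (y , By≐ax)
  with pureAB a (pad x) a≢0 (pad y , λ i → trans (▷-pad A B y i) (trans (cong-pad By≐ax i) (pad-⋆ a x i)))
  where
  cong-pad : ∀ {u v} → u ≐ v → pad u ≐ pad v
  cong-pad e 0F            = refl
  cong-pad e 1F            = refl
  cong-pad e (suc (suc i)) = e i
... | z , ABz≐padx = (λ i → z (2 ↑ʳ i)) , λ i → trans (sym (leading-zeros _)) (ABz≐padx (2 ↑ʳ i))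

-- The image of  hyperbolic d ⊞ B  contains d e₀, hence by purity e₀ itself.
pure-hyperbolic : ∀ {n} d (B : Mat n) → d ≢ 0ℤ → Pure (hyperbolic d ⊞ B) → IsUnit d
pure-hyperbolic {n} d B d≢0 pureM with pureM d e₀ d≢0 (e₁ , Me₁≐de₀)
  where
  e₀ e₁ : Vecℤ (2 ℕ.+ n)
  e₀ = λ { 0F → 1ℤ ; _ → 0ℤ }
  e₁ = λ { 1F → 1ℤ ; _ → 0ℤ }
  Me₁≐de₀ : ((hyperbolic d ⊞ B) ▷ e₁) ≐ (d ⋆ e₀)
  Me₁≐de₀ 0F            = hyperbolic-⊞-row0 d B e₁
  Me₁≐de₀ 1F            = trans (vanishing-terms {n} (- d) 0ℤ (λ _ → refl)) (sym (ℤP.*-zeroʳ d))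
  Me₁≐de₀ (suc (suc i)) = trans (leading-zeros _) (trans (Σ-zero (λ t → ℤP.*-zeroʳ (B i t))) (sym (ℤP.*-zeroʳ d)))
... | y , My≐e₀ = *≡1⇒unit d (y 1F) (trans (sym (hyperbolic-⊞-row0 d B y)) (My≐e₀ 0F))

pure⇒unitBlocks : ∀ {c} (s : SkewForm c) → AllBlocks (_≢ 0ℤ) s → Pure (matrix s) → AllBlocks IsUnit s
pure⇒unitBlocks zero-form _                 _        = tt
pure⇒unitBlocks (d ∷ s)   (d≢0 , nonzero) pureW =
  pure-hyperbolic d (matrix s) d≢0 pureW ,
  pure⇒unitBlocks s nonzero (pure-lowerRight (hyperbolic d) (matrix s) pureW)

-- Part (a)

record Represents {c} (W Z : Mat c) : Set where
  constructor represented
  field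
    Y        : Mat c
    Z≋YᵗWY   : Z ≋ sandwich Y W

∼⇒represents : ∀ {c} {Z W : Mat c} → Z ∼ W → Represents W Z
∼⇒represents (congruent Q _ _ eQ) = represented Q eQ

represents-trans : ∀ {c} {W X Z : Mat c} → Represents W X → Represents X Z → Represents W Z
represents-trans {W = W} (represented Y X≋YWY) (represented Y′ Z≋Y′XY′) =
  represented (Y · Y′) (≋-trans Z≋Y′XY′ (≋-trans (sandwich-cong Y′ X≋YWY) (sandwich-· Y′ Y W)))

diagonal : ℤ → Mat 2
diagonal e 0F 0F = 1ℤ
diagonal e 0F 1F = 0ℤ
diagonal e 1F 0F = 0ℤ
diagonal e 1F 1F = e

sandwich-diagonal : ∀ u e → sandwich (diagonal e) (hyperbolic u) ≋ hyperbolic (u * e)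
sandwich-diagonal u e 0F 0F = entry u e
  where
  entry : ∀ u e → 1ℤ * (0ℤ * 1ℤ + (u * 0ℤ + 0ℤ)) + (0ℤ * (- u * 1ℤ + (0ℤ * 0ℤ + 0ℤ)) + 0ℤ) ≡ 0ℤ
  entry = solve-∀
sandwich-diagonal u e 0F 1F = entry u e
  where
  entry : ∀ u e → 1ℤ * (0ℤ * 0ℤ + (u * e + 0ℤ)) + (0ℤ * (- u * 0ℤ + (0ℤ * e + 0ℤ)) + 0ℤ) ≡ u * e
  entry = solve-∀
sandwich-diagonal u e 1F 0F = entry u e
  where
  entry : ∀ u e → 0ℤ * (0ℤ * 1ℤ + (u * 0ℤ + 0ℤ)) + (e * (- u * 1ℤ + (0ℤ * 0ℤ + 0ℤ)) + 0ℤ) ≡ - (u * e)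
  entry = solve-∀
sandwich-diagonal u e 1F 1F = entry u e
  where
  entry : ∀ u e → 0ℤ * (0ℤ * 0ℤ + (u * e + 0ℤ)) + (e * (- u * 0ℤ + (0ℤ * e + 0ℤ)) + 0ℤ) ≡ 0ℤ
  entry = solve-∀

sandwich-O : ∀ {c} (G : Mat c) → sandwich O G ≋ O
sandwich-O {c} G i j = Σ-zero {c} (λ k → refl)

-- hyperbolic u  is carried to  hyperbolic d  by  diagonal (u * d), as u * (u * d) = d.
unitForm-represents : ∀ {c} (w : SkewForm c) → UnitForm w → (s : SkewForm c) → Represents (matrix w) (matrix s)
unitForm-represents (zero-form {0})     _  s = represented O (λ ())
unitForm-represents (zero-form {suc c}) ()
unitForm-represents (u ∷ w) (u² , unit) zero-form = represented O (≋-sym (sandwich-O (matrix (u ∷ w))))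
unitForm-represents (u ∷ w) (u² , unit) (d ∷ s) with unitForm-represents w unit s
... | represented S s≋SwS = represented (diagonal (u * d) ⊞ S) (
  ≋-sym (≋-trans (sandwich-⊞ (diagonal (u * d)) (hyperbolic u) S (matrix w))
                 (⊞-cong (≋-trans (sandwich-diagonal u (u * d)) (λ i j → cong (λ x → hyperbolic x i j) u·ud≡d))
                         (≋-sym s≋SwS))))
  where
  u·ud≡d : u * (u * d) ≡ d
  u·ud≡d = trans (sym (ℤP.*-assoc u u d)) (trans (cong (_* d) u²) (ℤP.*-identityˡ d))

invertible-represents : ∀ {c} {Z W : Mat c} → SkewSymmetric Z → SkewSymmetric W → ZInvertible W → Represents W Z
invertible-represents {c} {Z} {W} skewZ skewW invW =
  let w , _ , W∼w = normalForm c W skewW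
      s , _ , Z∼s = normalForm c Z skewZ
      unit = invertible⇒unitForm w (invertible-resp-∼ W∼w invW)
  in represents-trans (∼⇒represents (∼-sym W∼w)) (represents-trans (unitForm-represents w unit s) (∼⇒represents Z∼s))

-- Part (b)

record Solution {c} (W Z : Mat c) : Set where
  constructor solution
  field
    Y        : Mat c
    equation : Z ≋ ((Y ⊕ (⊖ (Y ᵗ))) ⊕ sandwich Y W)

skew-as-difference : ∀ {m} (Z : Mat m) → SkewSymmetric Z → ∃ λ Y → Z ≋ (Y ⊕ (⊖ (Y ᵗ)))
skew-as-difference {zero}  Z skewZ = O , λ ()
skew-as-difference {suc m} Z skewZ with skew-as-difference (λ i j → Z (suc i) (suc j)) (λ i j → skewZ (suc i) (suc j))
... | Y′ , Z′≋Y′-Y′ᵗ = Y , Z≋Y-Yᵗ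
  where
  Y : Mat (suc m)
  Y 0F      (suc j) = Z 0F (suc j)
  Y _       0F      = 0ℤ
  Y (suc i) (suc j) = Y′ i j
  Z≋Y-Yᵗ : Z ≋ (Y ⊕ (⊖ (Y ᵗ)))
  Z≋Y-Yᵗ 0F      0F      = skew-diag skewZ 0F
  Z≋Y-Yᵗ 0F      (suc j) = sym (ℤP.+-identityʳ _)
  Z≋Y-Yᵗ (suc i) 0F      = trans (skewZ 0F (suc i)) (sym (ℤP.+-identityˡ _))
  Z≋Y-Yᵗ (suc i) (suc j) = Z′≋Y′-Y′ᵗ i j

skew-matrix : ∀ {c} (s : SkewForm c) → SkewSymmetric (matrix s)
skew-matrix zero-form                     i             j             = refl
skew-matrix (d ∷ s) 0F            0F            = refl
skew-matrix (d ∷ s) 0F            1F            = refl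
skew-matrix (d ∷ s) 0F            (suc (suc j)) = refl
skew-matrix (d ∷ s) 1F            0F            = sym (ℤP.neg-involutive d)
skew-matrix (d ∷ s) 1F            1F            = refl
skew-matrix (d ∷ s) 1F            (suc (suc j)) = refl
skew-matrix (d ∷ s) (suc (suc i)) 0F            = refl
skew-matrix (d ∷ s) (suc (suc i)) 1F            = refl
skew-matrix (d ∷ s) (suc (suc i)) (suc (suc j)) = skew-matrix s i j

hyperbolic-square : ∀ u → IsUnit u → (hyperbolic u · hyperbolic u) ≋ (⊖ I)
hyperbolic-square u u² 0F 0F = trans (entry u) (cong -_ u²)
  where
  entry : ∀ u → 0ℤ * 0ℤ + (u * - u + 0ℤ) ≡ - (u * u)
  entry = solve-∀
hyperbolic-square u u² 0F 1F = entry u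
  where
  entry : ∀ u → 0ℤ * u + (u * 0ℤ + 0ℤ) ≡ 0ℤ
  entry = solve-∀
hyperbolic-square u u² 1F 0F = entry u
  where
  entry : ∀ u → - u * 0ℤ + (0ℤ * - u + 0ℤ) ≡ 0ℤ
  entry = solve-∀
hyperbolic-square u u² 1F 1F = trans (entry u) (cong -_ u²)
  where
  entry : ∀ u → - u * u + (0ℤ * 0ℤ + 0ℤ) ≡ - (u * u)
  entry = solve-∀

⊖-⊞ : ∀ {n} (A : Mat 2) (B : Mat n) → ((⊖ A) ⊞ (⊖ B)) ≋ (⊖ (A ⊞ B))
⊖-⊞ A B 0F            0F            = refl
⊖-⊞ A B 0F            1F            = refl
⊖-⊞ A B 0F            (suc (suc j)) = refl
⊖-⊞ A B 1F            0F            = refl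
⊖-⊞ A B 1F            1F            = refl
⊖-⊞ A B 1F            (suc (suc j)) = refl
⊖-⊞ A B (suc (suc i)) 0F            = refl
⊖-⊞ A B (suc (suc i)) 1F            = refl
⊖-⊞ A B (suc (suc i)) (suc (suc j)) = refl

unitForm-square : ∀ {c} (w : SkewForm c) → UnitForm w → (matrix w · matrix w) ≋ (⊖ I)
unitForm-square (zero-form {0})     _ = λ ()
unitForm-square (zero-form {suc c}) ()
unitForm-square (u ∷ w) (u² , unit) =
  ≋-trans (⊞-· (hyperbolic u) (hyperbolic u) (matrix w) (matrix w))
          (≋-trans (⊞-cong (hyperbolic-square u u²) (unitForm-square w unit))
                   (≋-trans (⊖-⊞ I I) (⊖-cong I⊞I)))

square≋-I⇒inverses : ∀ {c} {U : Mat c} → (U · U) ≋ (⊖ I) → Inverses U (⊖ U)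
square≋-I⇒inverses {U = U} U² = inverses (≋-trans (·-⊖ʳ U U) -U²≋I) (≋-trans (·-⊖ˡ U U) -U²≋I)
  where
  -U²≋I : (⊖ (U · U)) ≋ I
  -U²≋I i j = trans (cong -_ (U² i j)) (ℤP.neg-involutive _)

sandwich-⊕-expand : ∀ {c} (A B G : Mat c) →
  sandwich (A ⊕ B) G ≋ ((sandwich A G ⊕ ((A ᵗ) · (G · B))) ⊕ (((B ᵗ) · (G · A)) ⊕ sandwich B G))
sandwich-⊕-expand A B G =
  ≋-trans (·-congˡ ((A ⊕ B) ᵗ) (·-distribˡ-⊕ G A B))
    (≋-trans (·-distribʳ-⊕ (A ᵗ) (B ᵗ) ((G · A) ⊕ (G · B)))
             (⊕-cong (·-distribˡ-⊕ (A ᵗ) (G · A) (G · B)) (·-distribˡ-⊕ (B ᵗ) (G · A) (G · B))))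

-- If U² = -I, the substitution Y = X - U turns  Y - Yᵗ + YᵗUY  into  XᵗUX - U.
solution-from-representation : ∀ {c} {U Z : Mat c} → SkewSymmetric U → (U · U) ≋ (⊖ I) →
  Represents U (Z ⊕ U) → Solution U Z
solution-from-representation {c} {U} {Z} skewU U²≋-I (represented X Z+U≋XᵗUX) =
  solution Y (λ i j → trans (collect (sym (Z+U≋XᵗUX i j)) (cross₁ i j) (cross₂ i j) (corner i j) (skewU i j))
                            (cong (Y i j + - Y j i +_) (sym (sandwich-⊕-expand X (⊖ U) U i j))))
  where
  Y = X ⊕ (⊖ U)
  U·-U : (U · (⊖ U)) ≋ I
  U·-U = Inverses.PQ≋I (square≋-I⇒inverses {U = U} U²≋-I)
  -Uᵗ : ((⊖ U) ᵗ) ≋ U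
  -Uᵗ i j = trans (cong -_ (skewU i j)) (ℤP.neg-involutive _)
  cross₁ : ((X ᵗ) · (U · (⊖ U))) ≋ (X ᵗ)
  cross₁ = ≋-trans (·-congˡ (X ᵗ) U·-U) (·-identityʳ (X ᵗ))
  cross₂ : (((⊖ U) ᵗ) · (U · X)) ≋ (⊖ X)
  cross₂ = begin
    ((⊖ U) ᵗ) · (U · X) ≈⟨ ·-congʳ (U · X) -Uᵗ ⟩
    U · (U · X)         ≈⟨ ·-assoc U U X ⟨
    (U · U) · X         ≈⟨ ·-congʳ X U²≋-I ⟩
    (⊖ I) · X           ≈⟨ ·-⊖ˡ I X ⟩
    ⊖ (I · X)           ≈⟨ ⊖-cong (·-identityˡ X) ⟩
    ⊖ X                 ∎
    where open SetoidReasoning (≋-setoid c)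
  corner : sandwich (⊖ U) U ≋ U
  corner = ≋-trans (·-cong -Uᵗ U·-U) (·-identityʳ U)
  collect : ∀ {z u uᵗ a b s x₁ x₂ x₃} → s ≡ z + u → x₁ ≡ b → x₂ ≡ - a → x₃ ≡ u → uᵗ ≡ - u →
    z ≡ (a + - u + - (b + - uᵗ)) + ((s + x₁) + (x₂ + x₃))
  collect {z} {u} {a = a} {b} refl refl refl refl refl = identity z u a b
    where
    identity : ∀ z u a b → z ≡ (a + - u + - (b + - - u)) + ((z + u + b) + (- a + u))
    identity = solve-∀

unitForm-solution : ∀ {c} (w : SkewForm c) → UnitForm w → (Z : Mat c) → SkewSymmetric Z → Solution (matrix w) Z
unitForm-solution w unit Z skewZ = solution-from-representation (skew-matrix w) (unitForm-square w unit)
  (invertible-represents (skew-⊕ skewZ (skew-matrix w)) (skew-matrix w) (inverses⇒invertible (square≋-I⇒inverses (unitForm-square w unit))))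

unitPart : ∀ {c} → SkewForm c → ℕ
unitPart zero-form = 0
unitPart (d ∷ s)   = 2 ℕ.+ unitPart s

zeroPart : ∀ {c} → SkewForm c → ℕ
zeroPart (zero-form {c}) = c
zeroPart (d ∷ s)         = zeroPart s

blocks : ∀ {c} (s : SkewForm c) → SkewForm (unitPart s)
blocks zero-form = zero-form
blocks (d ∷ s)   = d ∷ blocks s

unitIndex : ∀ {c} (s : SkewForm c) → Fin (unitPart s) → Fin c
unitIndex (d ∷ s) 0F            = 0F
unitIndex (d ∷ s) 1F            = 1F
unitIndex (d ∷ s) (suc (suc a)) = 2 ↑ʳ unitIndex s a

zeroIndex : ∀ {c} (s : SkewForm c) → Fin (zeroPart s) → Fin c
zeroIndex zero-form b = b
zeroIndex (d ∷ s)   b = 2 ↑ʳ zeroIndex s b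

classify : ∀ {c} (s : SkewForm c) → Fin c → Fin (unitPart s) ⊎ Fin (zeroPart s)
classify zero-form     i             = inj₂ i
classify (d ∷ s)       0F            = inj₁ 0F
classify (d ∷ s)       1F            = inj₁ 1F
classify (d ∷ s)       (suc (suc i)) = Sum.map₁ (2 ↑ʳ_) (classify s i)

classify-unitIndex : ∀ {c} (s : SkewForm c) a → classify s (unitIndex s a) ≡ inj₁ a
classify-unitIndex (d ∷ s) 0F            = refl
classify-unitIndex (d ∷ s) 1F            = refl
classify-unitIndex (d ∷ s) (suc (suc a)) = cong (Sum.map₁ (2 ↑ʳ_)) (classify-unitIndex s a)

classify-zeroIndex : ∀ {c} (s : SkewForm c) b → classify s (zeroIndex s b) ≡ inj₂ b
classify-zeroIndex zero-form b = refl
classify-zeroIndex (d ∷ s)   b = cong (Sum.map₁ (2 ↑ʳ_)) (classify-zeroIndex s b)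

data Index {c} (s : SkewForm c) : Fin c → Set where
  unit : ∀ a → Index s (unitIndex s a)
  zero : ∀ b → Index s (zeroIndex s b)

index : ∀ {c} (s : SkewForm c) i → Index s i
index zero-form i             = zero i
index (d ∷ s)   0F            = unit 0F
index (d ∷ s)   1F            = unit 1F
index (d ∷ s)   (suc (suc i)) with index s i
... | unit a = unit (2 ↑ʳ a)
... | zero b = zero b

Σ-split : ∀ {c} (s : SkewForm c) (f : Fin c → ℤ) →
  Σℤ f ≡ Σℤ (λ a → f (unitIndex s a)) + Σℤ (λ b → f (zeroIndex s b))
Σ-split zero-form f = sym (ℤP.+-identityˡ _)
Σ-split (d ∷ s)   f =
  trans (cong (λ z → f 0F + (f 1F + z)) (Σ-split s (λ i → f (2 ↑ʳ i)))) (reassociate (f 0F) (f 1F) _ _)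
  where
  reassociate : ∀ x y a b → x + (y + (a + b)) ≡ (x + (y + a)) + b
  reassociate = solve-∀

matrix-unitIndex : ∀ {c} (s : SkewForm c) a b → matrix s (unitIndex s a) (unitIndex s b) ≡ matrix (blocks s) a b
matrix-unitIndex (d ∷ s) 0F            0F            = refl
matrix-unitIndex (d ∷ s) 0F            1F            = refl
matrix-unitIndex (d ∷ s) 0F            (suc (suc b)) = refl
matrix-unitIndex (d ∷ s) 1F            0F            = refl
matrix-unitIndex (d ∷ s) 1F            1F            = refl
matrix-unitIndex (d ∷ s) 1F            (suc (suc b)) = refl
matrix-unitIndex (d ∷ s) (suc (suc a)) 0F            = refl
matrix-unitIndex (d ∷ s) (suc (suc a)) 1F            = refl
matrix-unitIndex (d ∷ s) (suc (suc a)) (suc (suc b)) = matrix-unitIndex s a b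

matrix-zeroRow : ∀ {c} (s : SkewForm c) b j → matrix s (zeroIndex s b) j ≡ 0ℤ
matrix-zeroRow zero-form b j             = refl
matrix-zeroRow (d ∷ s)   b 0F            = refl
matrix-zeroRow (d ∷ s)   b 1F            = refl
matrix-zeroRow (d ∷ s)   b (suc (suc j)) = matrix-zeroRow s b j

matrix-zeroColumn : ∀ {c} (s : SkewForm c) i b → matrix s i (zeroIndex s b) ≡ 0ℤ
matrix-zeroColumn s i b = trans (skew-matrix s (zeroIndex s b) i) (cong -_ (matrix-zeroRow s b i))

unitBlocks⇒unitForm : ∀ {c} (s : SkewForm c) → AllBlocks IsUnit s → UnitForm (blocks s)
unitBlocks⇒unitForm zero-form _             = refl
unitBlocks⇒unitForm (d ∷ s)   (d² , units) = d² , unitBlocks⇒unitForm s units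

sandwich-form : ∀ {c} (s : SkewForm c) (Y : Mat c) i j →
  sandwich Y (matrix s) i j
    ≡ Σℤ (λ a → Y (unitIndex s a) i * Σℤ (λ b → matrix (blocks s) a b * Y (unitIndex s b) j))
sandwich-form s Y i j = begin
  Σℤ (λ k → Y k i * (W · Y) k j)
    ≡⟨ Σ-split s (λ k → Y k i * (W · Y) k j) ⟩
  Σℤ (λ a → Y (unitIndex s a) i * (W · Y) (unitIndex s a) j) + Σℤ (λ r → Y (zeroIndex s r) i * (W · Y) (zeroIndex s r) j)
    ≡⟨ cong₂ _+_ (Σ-cong (λ a → cong (Y (unitIndex s a) i *_) (unitRow a)))
                 (Σ-zero (λ r → trans (cong (Y (zeroIndex s r) i *_) (zeroRow r)) (ℤP.*-zeroʳ (Y (zeroIndex s r) i)))) ⟩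
  Σℤ (λ a → Y (unitIndex s a) i * Σℤ (λ b → matrix (blocks s) a b * Y (unitIndex s b) j)) + 0ℤ
    ≡⟨ ℤP.+-identityʳ _ ⟩
  Σℤ (λ a → Y (unitIndex s a) i * Σℤ (λ b → matrix (blocks s) a b * Y (unitIndex s b) j)) ∎
  where
  open ≡-Reasoning
  W = matrix s
  zeroRow : ∀ r → (W · Y) (zeroIndex s r) j ≡ 0ℤ
  zeroRow r = Σ-zero (λ k → cong (_* Y k j) (matrix-zeroRow s r k))
  unitRow : ∀ a → (W · Y) (unitIndex s a) j ≡ Σℤ (λ b → matrix (blocks s) a b * Y (unitIndex s b) j)
  unitRow a = begin
    Σℤ (λ k → W (unitIndex s a) k * Y k j)
      ≡⟨ Σ-split s (λ k → W (unitIndex s a) k * Y k j) ⟩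
    Σℤ (λ b → W (unitIndex s a) (unitIndex s b) * Y (unitIndex s b) j) + Σℤ (λ r → W (unitIndex s a) (zeroIndex s r) * Y (zeroIndex s r) j)
      ≡⟨ cong₂ _+_ (Σ-cong (λ b → cong (_* Y (unitIndex s b) j) (matrix-unitIndex s a b)))
                   (Σ-zero (λ r → cong (_* Y (zeroIndex s r) j) (matrix-zeroColumn s (unitIndex s a) r))) ⟩
    Σℤ (λ b → matrix (blocks s) a b * Y (unitIndex s b) j) + 0ℤ
      ≡⟨ ℤP.+-identityʳ _ ⟩
    Σℤ (λ b → matrix (blocks s) a b * Y (unitIndex s b) j) ∎

sandwich-form-vanishes : ∀ {c} (s : SkewForm c) (Y : Mat c) i j →
  (∀ a → Y (unitIndex s a) i ≡ 0ℤ) ⊎ (∀ b → Y (unitIndex s b) j ≡ 0ℤ) → sandwich Y (matrix s) i j ≡ 0ℤ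
sandwich-form-vanishes s Y i j cases = trans (sandwich-form s Y i j) (Σ-zero (vanish cases))
  where
  N = unitIndex s
  U = matrix (blocks s)
  vanish : (∀ a → Y (N a) i ≡ 0ℤ) ⊎ (∀ b → Y (N b) j ≡ 0ℤ) → ∀ a → Y (N a) i * Σℤ (λ b → U a b * Y (N b) j) ≡ 0ℤ
  vanish (inj₁ Y·i≡0) a = cong (_* Σℤ (λ b → U a b * Y (N b) j)) (Y·i≡0 a)
  vanish (inj₂ Y·j≡0) a =
    trans (cong (Y (N a) i *_) (Σ-zero (λ b → trans (cong (U a b *_) (Y·j≡0 b)) (ℤP.*-zeroʳ (U a b)))))
          (ℤP.*-zeroʳ (Y (N a) i))

sandwich-form-unitPart : ∀ {c} (s : SkewForm c) (Y : Mat c) (Y₁ : Mat (unitPart s)) →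
  (∀ a b → Y (unitIndex s a) (unitIndex s b) ≡ Y₁ a b) →
  ∀ a b → sandwich Y (matrix s) (unitIndex s a) (unitIndex s b) ≡ sandwich Y₁ (matrix (blocks s)) a b
sandwich-form-unitPart s Y Y₁ Y≡Y₁ a b =
  trans (sandwich-form s Y (unitIndex s a) (unitIndex s b))
        (Σ-cong (λ a′ → cong₂ _*_ (Y≡Y₁ a′ a) (Σ-cong (λ b′ → cong (matrix (blocks s) a′ b′ *_) (Y≡Y₁ b′ b)))))

assemble : ∀ {c} (s : SkewForm c) → Mat (unitPart s) → Mat (zeroPart s) →
  (Fin (zeroPart s) → Fin (unitPart s) → ℤ) → Mat c
assemble s Y₁ Y₂ C i j = block (classify s i) (classify s j)
  where
  block : Fin (unitPart s) ⊎ Fin (zeroPart s) → Fin (unitPart s) ⊎ Fin (zeroPart s) → ℤ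
  block (inj₁ a) (inj₁ b) = Y₁ a b
  block (inj₁ a) (inj₂ b) = 0ℤ
  block (inj₂ a) (inj₁ b) = C a b
  block (inj₂ a) (inj₂ b) = Y₂ a b

module Assembled {c} (s : SkewForm c) (Y₁ : Mat (unitPart s)) (Y₂ : Mat (zeroPart s)) (C : Fin (zeroPart s) → Fin (unitPart s) → ℤ) where
  private
    N = unitIndex s
    R = zeroIndex s
    Y = assemble s Y₁ Y₂ C

  assemble-unit-unit : ∀ a b → Y (N a) (N b) ≡ Y₁ a b
  assemble-unit-unit a b rewrite classify-unitIndex s a | classify-unitIndex s b = refl

  assemble-unit-zero : ∀ a b → Y (N a) (R b) ≡ 0ℤ
  assemble-unit-zero a b rewrite classify-unitIndex s a | classify-zeroIndex s b = refl

  assemble-zero-unit : ∀ a b → Y (R a) (N b) ≡ C a b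
  assemble-zero-unit a b rewrite classify-zeroIndex s a | classify-unitIndex s b = refl

  assemble-zero-zero : ∀ a b → Y (R a) (R b) ≡ Y₂ a b
  assemble-zero-zero a b rewrite classify-zeroIndex s a | classify-zeroIndex s b = refl

-- The unit-by-zero block of Y vanishes, so YᵗWY lives on the unit block and the other
-- three blocks of the equation are linear in Y.
assembled-solution : ∀ {c} (s : SkewForm c) (Z : Mat c) → SkewSymmetric Z →
  Solution (matrix (blocks s)) (λ a b → Z (unitIndex s a) (unitIndex s b)) →
  (∃ λ Y₂ → (λ a b → Z (zeroIndex s a) (zeroIndex s b)) ≋ (Y₂ ⊕ (⊖ (Y₂ ᵗ)))) →
  Solution (matrix s) Z
assembled-solution {c} s Z skewZ (solution Y₁ Z₁≋) (Y₂ , Z₂≋) = solution Y equation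
  where
  N = unitIndex s
  R = zeroIndex s
  C = λ a b → - Z (N b) (R a)
  Y = assemble s Y₁ Y₂ C
  open Assembled s Y₁ Y₂ C
  plus-zero : ∀ {z y q} → q ≡ 0ℤ → z ≡ y → z ≡ y + q
  plus-zero {y = y} refl z≡y = trans z≡y (sym (ℤP.+-identityʳ y))
  open ≡-Reasoning
  equation : Z ≋ ((Y ⊕ (⊖ (Y ᵗ))) ⊕ sandwich Y (matrix s))
  equation i j with index s i | index s j
  ... | unit a | unit b = trans (Z₁≋ a b)
    (cong₂ _+_ (cong₂ (λ p q → p + - q) (sym (assemble-unit-unit a b)) (sym (assemble-unit-unit b a)))
               (sym (sandwich-form-unitPart s Y Y₁ assemble-unit-unit a b)))
  ... | unit a | zero b = plus-zero (sandwich-form-vanishes s Y _ _ (inj₂ (λ a′ → assemble-unit-zero a′ b))) (begin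
    Z (N a) (R b)                     ≡⟨ ℤP.neg-involutive _ ⟨
    - - Z (N a) (R b)                 ≡⟨ ℤP.+-identityˡ _ ⟨
    0ℤ + - - Z (N a) (R b)            ≡⟨ cong₂ (λ p q → p + - q) (assemble-unit-zero a b) (assemble-zero-unit b a) ⟨
    Y (N a) (R b) + - Y (R b) (N a)   ∎)
  ... | zero a | unit b = plus-zero (sandwich-form-vanishes s Y _ _ (inj₁ (λ a′ → assemble-unit-zero a′ a))) (begin
    Z (R a) (N b)                     ≡⟨ ℤP.neg-involutive _ ⟨
    - - Z (R a) (N b)                 ≡⟨ cong -_ (skewZ (R a) (N b)) ⟨
    - Z (N b) (R a)                   ≡⟨ ℤP.+-identityʳ _ ⟨
    - Z (N b) (R a) + - 0ℤ            ≡⟨ cong₂ (λ p q → p + - q) (assemble-zero-unit a b) (assemble-unit-zero b a) ⟨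
    Y (R a) (N b) + - Y (N b) (R a)   ∎)
  ... | zero a | zero b = plus-zero (sandwich-form-vanishes s Y _ _ (inj₁ (λ a′ → assemble-unit-zero a′ a)))
    (trans (Z₂≋ a b)
           (cong₂ (λ p q → p + - q) (sym (assemble-zero-zero a b)) (sym (assemble-zero-zero b a))))

unitBlocks-solution : ∀ {c} (s : SkewForm c) → AllBlocks IsUnit s → (Z : Mat c) → SkewSymmetric Z →
  Solution (matrix s) Z
unitBlocks-solution s units Z skewZ = assembled-solution s Z skewZ
  (unitForm-solution (blocks s) (unitBlocks⇒unitForm s units) _ (λ a b → skewZ (unitIndex s a) (unitIndex s b)))
  (skew-as-difference _ (λ a b → skewZ (zeroIndex s a) (zeroIndex s b)))

solution-resp-≋ : ∀ {c} {W W′ Z Z′ : Mat c} → W ≋ W′ → Z ≋ Z′ → Solution W Z → Solution W′ Z′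
solution-resp-≋ {W = W} {W′} W≋W′ Z≋Z′ (solution Y e) =
  solution Y (≋-trans (≋-sym Z≋Z′) (≋-trans e (⊕-cong {A = Y ⊕ (⊖ (Y ᵗ))} ≋-refl (sandwich-cong Y W≋W′))))

-- The equation is covariant: Y ↦ Aᵗ Y A carries solutions for (D, Z) to solutions for
-- (Bᵗ D B, Aᵗ Z A) once B Aᵗ = I.
solution-sandwich : ∀ {c} {D Z : Mat c} (A B : Mat c) → (B · (A ᵗ)) ≋ I → Solution D Z →
  Solution (sandwich B D) (sandwich A Z)
solution-sandwich {c} {D} {Z} A B BAᵗ≋I (solution Y₀ Z≋) = solution Y (begin
  sandwich A Z                                                    ≈⟨ sandwich-cong A Z≋ ⟩
  sandwich A ((Y₀ ⊕ (⊖ (Y₀ ᵗ))) ⊕ sandwich Y₀ D)                  ≈⟨ sandwich-⊕ A (Y₀ ⊕ (⊖ (Y₀ ᵗ))) (sandwich Y₀ D) ⟩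
  sandwich A (Y₀ ⊕ (⊖ (Y₀ ᵗ))) ⊕ sandwich A (sandwich Y₀ D)       ≈⟨ ⊕-cong difference quadratic ⟩
  (Y ⊕ (⊖ (Y ᵗ))) ⊕ sandwich Y (sandwich B D)                     ∎)
  where
  open SetoidReasoning (≋-setoid c)
  Y = sandwich A Y₀
  BY≋Y₀A : (B · Y) ≋ (Y₀ · A)
  BY≋Y₀A = begin
    B · ((A ᵗ) · (Y₀ · A))   ≈⟨ ·-assoc B (A ᵗ) (Y₀ · A) ⟨
    (B · (A ᵗ)) · (Y₀ · A)   ≈⟨ ·-congʳ (Y₀ · A) BAᵗ≋I ⟩
    I · (Y₀ · A)             ≈⟨ ·-identityˡ (Y₀ · A) ⟩
    Y₀ · A                   ∎
  quadratic : sandwich A (sandwich Y₀ D) ≋ sandwich Y (sandwich B D)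
  quadratic = begin
    sandwich A (sandwich Y₀ D)   ≈⟨ sandwich-· A Y₀ D ⟩
    sandwich (Y₀ · A) D          ≈⟨ sandwich-congˡ D BY≋Y₀A ⟨
    sandwich (B · Y) D           ≈⟨ sandwich-· Y B D ⟨
    sandwich Y (sandwich B D)    ∎
  difference : sandwich A (Y₀ ⊕ (⊖ (Y₀ ᵗ))) ≋ (Y ⊕ (⊖ (Y ᵗ)))
  difference = begin
    sandwich A (Y₀ ⊕ (⊖ (Y₀ ᵗ)))             ≈⟨ sandwich-⊕ A Y₀ (⊖ (Y₀ ᵗ)) ⟩
    Y ⊕ sandwich A (⊖ (Y₀ ᵗ))                ≈⟨ ⊕-cong {A = Y} ≋-refl (sandwich-⊖ A (Y₀ ᵗ)) ⟩
    Y ⊕ (⊖ sandwich A (Y₀ ᵗ))                ≈⟨ ⊕-cong {A = Y} ≋-refl (⊖-cong (sandwich-ᵗ A Y₀)) ⟨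
    Y ⊕ (⊖ (Y ᵗ))                            ∎

pure-solution : ∀ {c} {Z W : Mat c} → SkewSymmetric Z → SkewSymmetric W → Pure W → Solution W Z
pure-solution {c} {Z} {W} skewZ skewW pureW with normalForm c W skewW
... | w , nonzero , W∼w@(congruent Q Q⁻¹ (inverses QQ⁻¹ Q⁻¹Q) W≋QᵗwQ) =
  solution-resp-≋ (≋-sym W≋QᵗwQ) Z′≋Z
    (solution-sandwich (Q⁻¹ ᵗ) Q QQ⁻¹
      (unitBlocks-solution w units (sandwich (Q ᵗ) Z) (skew-sandwich (Q ᵗ) skewZ)))
  where
  units = pure⇒unitBlocks w nonzero (pure-resp-∼ W∼w pureW)
  Z′≋Z : sandwich (Q⁻¹ ᵗ) (sandwich (Q ᵗ) Z) ≋ Z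
  Z′≋Z = ≋-trans (sandwich-· (Q⁻¹ ᵗ) (Q ᵗ) Z)
           (≋-trans (sandwich-congˡ Z (ᵗ-inverse Q Q⁻¹ Q⁻¹Q)) (sandwich-I Z))

lemma3p1 : (c : ℕ) (Z W : Mat c) → SkewSymmetric Z → SkewSymmetric W →
    (ZInvertible W → ∃ λ (Y : Mat c) → Z ≋ ((Y ᵗ) · (W · Y)))
    × (Pure W → ∃ λ (Y : Mat c) → Z ≋ ((Y ⊕ (⊖ (Y ᵗ))) ⊕ ((Y ᵗ) · (W · Y))))
lemma3p1 c Z W skewZ skewW =
  (λ invW → let open Represents (invertible-represents skewZ skewW invW) in Y , Z≋YᵗWY) ,
  (λ pureW → let open Solution (pure-solution skewZ skewW pureW) in Y , equation)
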